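{- For all positive integers $k,m,n$, \[ \begin{aligned} &\#\{(\lambda,i_1,\dots,i_m) : \lambda\in\mathcal{SP}(n),\ 1\le i_1<\cdots<i_m\le\lambda_{\ell(\lambda)},\ a_{1,i_m}(\lambda)=k,\ \ell(\lambda)\text{ odd}\}\\ -&\#\{(\lambda,i_1,\dots,i_m) : \lambda\in\mathcal{SP}(n),\ 1\le i_1<\cdots<i_m\le\lambda_{\ell(\lambda)},\ a_{1,i_m}(\lambda)=k,\ \ell(\lambda)\text{ even}\}\\ =&\#\{(\lambda,t_1,\dots,t_{m-c(\lambda)}) : \lambda\in\mathcal{P}(n),\ \lambda_1=k,\ 1\le t_1<\cdots<t_{m-c(\lambda)}<\ell(\lambda),\ \lambda_{t_i}=\lambda_{t_i+1}\text{ for all } i\}. \end{aligned} \] (Here, for a given $\lambda$, if $m-c(\lambda)<0$ there are no such tuples, and if $m-c(\lambda)=0$ the empty tuple counts once.)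
   Context: A partition $\lambda$ of a positive integer $n$ is a sequence of integers $\lambda=(\lambda_1,\dots,\lambda_\ell)$ with $\lambda_1\ge\cdots\ge\lambda_\ell>0$ and $\sum_i\lambda_i=n$; $\ell(\lambda):=\ell$ is its length. $\mathcal{P}(n)$ is the set of partitions of $n$; $\lambda$ is strict if $\lambda_1>\cdots>\lambda_\ell>0$, and $\mathcal{SP}(n)$ is the set of strict partitions of $n$. The Young diagram is $Y(\lambda)=\{(i,j): 1\le i\le\ell,\ 1\le j\le\lambda_i\}$. The (shifted) arm length is $a_{ij}(\lambda):=\lambda_i-j+1$ (so $a_{1,j}(\lambda)=\lambda_1-j+1$). The set of corners is $C(\lambda)=\{(i,j)\in Y(\lambda): (i+1,j)\notin Y(\lambda),\ (i,j+1)\notin Y(\lambda)\}$ and $c(\lambda):=\#C(\lambda)$ (equivalently, the number of distinct part sizes of $\lambda$). -}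

module Defs where

open import Data.Nat using (ℕ; zero; suc; _+_; _∸_; _≤_; _<_; _≥_; _>_; _%_)
open import Data.Nat.Properties using (_≟_)
open import Data.Bool using (if_then_else_)
open import Data.List using (List; []; _∷_; length)
open import Data.Nat.ListAction using (sum)
open import Data.List.Relation.Unary.All using (All)
open import Data.List.Relation.Unary.Linked using (Linked)
open import Data.List.Relation.Unary.Unique.Propositional using (Unique)
open import Data.List.Membership.Propositional using (_∈_)
open import Data.Product using (_×_; _,_)
open import Function.Bundles using (_⇔_)
open import Relation.Nullary.Decidable using (⌊_⌋)
open import Relation.Binary.PropositionalEquality using (_≡_)

IsPartition : ℕ → List ℕ → Set
IsPartition n lam = Linked _≥_ lam × All (0 <_) lam × sum lam ≡ n

IsStrictPartition : ℕ → List ℕ → Set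
IsStrictPartition n lam = Linked _>_ lam × All (0 <_) lam × sum lam ≡ n

-- 1-indexed part lam_i (0 outside 1..ℓ).
part : List ℕ → ℕ → ℕ
part []      _             = 0
part (x ∷ _) zero          = 0
part (x ∷ _) (suc zero)    = x
part (_ ∷ xs) (suc (suc i)) = part xs (suc i)

-- last element of a list (0 for the empty list); used for lam_{ℓ(lam)} and i_m
lastElem : List ℕ → ℕ
lastElem []           = 0
lastElem (x ∷ [])     = x
lastElem (_ ∷ y ∷ ys) = lastElem (y ∷ ys)

arm1 : List ℕ → ℕ → ℕ
arm1 lam j = part lam 1 ∸ j + 1

-- c(lam): number of corners of Y(lam). Row i has a corner (the cell (i,lam_i))
-- iff i = ℓ or lam_{i+1} < lam_i, i.e. lam_{i+1} ≠ lam_i for a partition.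
corners : List ℕ → ℕ
corners []           = 0
corners (x ∷ [])     = 1
corners (x ∷ y ∷ ys) = (if ⌊ x ≟ y ⌋ then 0 else 1) + corners (y ∷ ys)

Odd : ℕ → Set
Odd n = n % 2 ≡ 1

Even : ℕ → Set
Even n = n % 2 ≡ 0

-- "xs is a duplicate-free list whose members are exactly the elements satisfying P",
-- so length xs = #{x : P x}.
Enumerates : {A : Set} → (A → Set) → List A → Set
Enumerates {A} P xs = Unique xs × ((x : A) → (x ∈ xs ⇔ P x))

LeftTuple : ℕ → ℕ → ℕ → List ℕ × List ℕ → Set
LeftTuple k m n (lam , is) =
  IsStrictPartition n lam × length is ≡ m × Linked _<_ is
  × All (λ i → 1 ≤ i × i ≤ lastElem lam) is × arm1 lam (lastElem is) ≡ k

RightTuple : ℕ → ℕ → ℕ → List ℕ × List ℕ → Set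
RightTuple k m n (lam , ts) =
  IsPartition n lam × part lam 1 ≡ k × corners lam ≤ m × length ts + corners lam ≡ m
  × Linked _<_ ts
  × All (λ t → 1 ≤ t × t < length lam × part lam t ≡ part lam (suc t)) ts

module Submission where

-- A left tuple is determined by j = i_m, the prefix (i₁ … i_{m-1}) ⊂ [1, j-1]
--   and the strict partition (λ₂ > … > λ_ℓ) with parts in [j, j+k-1), since λ₁ = j + k - 1.
--   So the signed count is  leftSum k m n = Σ_j C(j-1, m-1) · [q^{n-j-k+1}] ∏_{j ≤ s < j+k-1} (1 - q^s)
--   (SubsetCounts and LeftCount count the pieces; LeftFormula defines leftSum).
-- * Right side.  Removing the first row k of λ gives the first-row recursion
--   R k m (k+d) = [d = 0, m = 1] + R k m d + R k (m-1) d + Σ_{h<k} R h (m-1) d   (RightCount).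
-- * leftSum obeys the same recursion (leftSum-recursion: Pascal's rule and a product identity
--   for ∏ (1 - q^s) proved in SignedCounts), and agrees with R for k = 1; hence the two
--   coincide by induction on k and n (FirstRowRecursion.Uniqueness).
-- Cardinalities are handled in Counting: a predicate "has c elements" when it is enumerated
-- by a duplicate-free list of length c, with rules for unions, products, images and fibres.

module Counting where

  open import Defs using (Enumerates)
  open import Data.Nat using (ℕ; zero; suc; _+_; _*_; _≤_; z≤n; s≤s)
  open import Data.Nat.Properties using (≤-refl; ≤-pred; <⇒≱; m≤n⇒m≤1+n; m≤n⇒m<n∨m≡n)
  open import Data.List using (List; []; _∷_; length; map; _++_; cartesianProduct)
  open import Data.List.Properties using (length-++; length-map)
  open import Data.List.Relation.Unary.All as All using (All; []; _∷_)
  open import Data.List.Relation.Unary.AllPairs using ([]; _∷_)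
  open import Data.List.Relation.Unary.Any using (here; there)
  open import Data.List.Relation.Unary.Unique.Propositional using (Unique)
  open import Data.List.Relation.Unary.Unique.Propositional.Properties using (++⁺; cartesianProduct⁺)
  open import Data.List.Membership.Propositional using (_∈_)
  open import Data.List.Membership.Propositional.Properties
    using (∈-map⁺; ∈-map⁻; ∈-++⁺ˡ; ∈-++⁺ʳ; ∈-++⁻; ∈-cartesianProduct⁺; ∈-cartesianProduct⁻)
  open import Data.List.Membership.Propositional.Properties.WithK using (unique∧set⇒bag)
  open import Data.List.Relation.Binary.BagAndSetEquality using (∼bag⇒↭)
  open import Data.List.Relation.Binary.Permutation.Propositional.Properties using (↭-length)
  open import Data.Product using (Σ; _×_; _,_; proj₁; proj₂)
  open import Data.Sum using (_⊎_; inj₁; inj₂)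
  open import Data.Empty using (⊥; ⊥-elim)
  open import Function.Bundles using (_⇔_; mk⇔; Equivalence)
  open import Relation.Nullary using (¬_)
  open import Relation.Binary.PropositionalEquality using (_≡_; _≢_; refl; sym; trans; cong; cong₂; subst)

  private
    to : {P Q : Set} → P ⇔ Q → P → Q
    to = Equivalence.to

    from : {P Q : Set} → P ⇔ Q → Q → P
    from = Equivalence.from

  HasCard : {A : Set} → (A → Set) → ℕ → Set
  HasCard {A} P c = Σ (List A) λ xs → Enumerates P xs × length xs ≡ c

  -- Two duplicate-free enumerations of the same predicate are permutations of each other.
  enumerations-same-length : {A : Set} {P : A → Set} {xs ys : List A} →
    Enumerates P xs → Enumerates P ys → length xs ≡ length ys
  enumerations-same-length (ux , ex) (uy , ey) =
    ↭-length (∼bag⇒↭ (unique∧set⇒bag ux uy (λ {x} →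
      mk⇔ (λ x∈xs → from (ey x) (to (ex x) x∈xs)) (λ x∈ys → from (ex x) (to (ey x) x∈ys)))))

  card-unique : {A : Set} {P : A → Set} {a b : ℕ} → HasCard P a → HasCard P b → a ≡ b
  card-unique (xs , ex , lx) (ys , ey , ly) = trans (sym lx) (trans (enumerations-same-length ex ey) ly)

  card-length : {A : Set} {P : A → Set} {xs : List A} {c : ℕ} → HasCard P c → Enumerates P xs → length xs ≡ c
  card-length (ys , ey , ly) ex = trans (enumerations-same-length ex ey) ly

  card-cong : {A : Set} {P Q : A → Set} {c : ℕ} → (∀ x → P x → Q x) → (∀ x → Q x → P x) →
    HasCard P c → HasCard Q c
  card-cong pq qp (xs , (u , e) , l) = xs , (u , λ x → mk⇔ (λ m → pq x (to (e x) m)) (λ q → from (e x) (qp x q))) , l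

  card-empty : {A : Set} {P : A → Set} → (∀ x → ¬ P x) → HasCard P 0
  card-empty ¬P = [] , ([] , λ x → mk⇔ (λ ()) (λ p → ⊥-elim (¬P x p))) , refl

  card-single : {A : Set} (a : A) → HasCard (_≡ a) 1
  card-single a = (a ∷ []) , (([] ∷ []) , λ x → mk⇔ (λ { (here e) → e ; (there ()) }) here) , refl

  card-image : {A B : Set} {P : A → Set} {c : ℕ} (f : A → B) (g : B → A) → (∀ x → P x → g (f x) ≡ x) →
    HasCard P c → HasCard (λ y → P (g y) × f (g y) ≡ y) c
  card-image {A} {P = P} f g gf (xs , (u , e) , l) =
    map f xs , (map-unique (All.tabulate λ {x} m → to (e x) m) u , member) , trans (length-map f xs) l
    where
    injective : ∀ {x y} → P x → P y → f x ≡ f y → x ≡ y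
    injective {x} {y} px py fx≡fy = trans (sym (gf x px)) (trans (cong g fx≡fy) (gf y py))

    map-unique : {ys : List A} → All P ys → Unique ys → Unique (map f ys)
    map-unique [] [] = []
    map-unique (px ∷ ps) (x∉ys ∷ u) = fresh px ps x∉ys ∷ map-unique ps u
      where
      fresh : ∀ {x ys} → P x → All P ys → All (x ≢_) ys → All (f x ≢_) (map f ys)
      fresh px [] [] = []
      fresh px (py ∷ ps) (x≢y ∷ ns) = (λ fx≡fy → x≢y (injective px py fx≡fy)) ∷ fresh px ps ns

    member : ∀ y → y ∈ map f xs ⇔ (P (g y) × f (g y) ≡ y)
    member y = mk⇔ (forward y) (λ { (pg , fg) → subst (_∈ map f xs) fg (∈-map⁺ f (from (e (g y)) pg)) })
      where
      forward : ∀ y → y ∈ map f xs → P (g y) × f (g y) ≡ y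
      forward y m =
        let (x , x∈xs , y≡fx) = ∈-map⁻ f m ; px = to (e x) x∈xs in
        subst (λ z → P (g z) × f (g z) ≡ z) (sym y≡fx) (subst P (sym (gf x px)) px , cong f (gf x px))

  card-union : {A : Set} {P Q : A → Set} {a b : ℕ} → (∀ x → P x → Q x → ⊥) →
    HasCard P a → HasCard Q b → HasCard (λ x → P x ⊎ Q x) (a + b)
  card-union {P = P} {Q} disjoint (xs , (ux , ex) , lx) (ys , (uy , ey) , ly) =
    xs ++ ys ,
    (++⁺ ux uy (λ { (m₁ , m₂) → disjoint _ (to (ex _) m₁) (to (ey _) m₂) }) ,
     λ x → mk⇔ (λ m → side (∈-++⁻ xs m))
                (λ { (inj₁ p) → ∈-++⁺ˡ (from (ex x) p) ; (inj₂ q) → ∈-++⁺ʳ xs (from (ey x) q) })) ,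
    trans (length-++ xs) (cong₂ _+_ lx ly)
    where
    side : ∀ {x} → x ∈ xs ⊎ x ∈ ys → P x ⊎ Q x
    side (inj₁ m) = inj₁ (to (ex _) m)
    side (inj₂ m) = inj₂ (to (ey _) m)

  card-prod : {A B : Set} {P : A → Set} {Q : B → Set} {a b : ℕ} →
    HasCard P a → HasCard Q b → HasCard (λ z → P (proj₁ z) × Q (proj₂ z)) (a * b)
  card-prod (xs , (ux , ex) , lx) (ys , (uy , ey) , ly) =
    cartesianProduct xs ys ,
    (cartesianProduct⁺ ux uy ,
     λ { (x , y) → mk⇔ (λ m → let (m₁ , m₂) = ∈-cartesianProduct⁻ xs ys m in to (ex x) m₁ , to (ey y) m₂)
                        (λ { (p , q) → ∈-cartesianProduct⁺ (from (ex x) p) (from (ey y) q) }) }) ,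
    trans (length-cartesianProduct xs ys) (cong₂ _*_ lx ly)
    where
    length-cartesianProduct : {A B : Set} (xs : List A) (ys : List B) →
      length (cartesianProduct xs ys) ≡ length xs * length ys
    length-cartesianProduct [] ys = refl
    length-cartesianProduct (x ∷ xs) ys =
      trans (length-++ (map (x ,_) ys)) (cong₂ _+_ (length-map (x ,_) ys) (length-cartesianProduct xs ys))

  sumTo : ℕ → (ℕ → ℕ) → ℕ
  sumTo zero f = 0
  sumTo (suc B) f = sumTo B f + f (suc B)

  card-fibres : {A : Set} (h : A → ℕ) (Q : ℕ → A → Set) (c : ℕ → ℕ) (B : ℕ) →
    (∀ i → 1 ≤ i → i ≤ B → HasCard (λ x → h x ≡ i × Q i x) (c i)) →
    HasCard (λ x → 1 ≤ h x × h x ≤ B × Q (h x) x) (sumTo B c)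
  card-fibres h Q c zero fibre = card-empty (λ { x (1≤h , h≤0 , _) → <⇒≱ 1≤h h≤0 })
  card-fibres h Q c (suc B) fibre =
    card-cong merge split
      (card-union (λ { x (_ , h≤B , _) (h≡1+B , _) → <⇒≱ (subst (suc B ≤_) (sym h≡1+B) ≤-refl) h≤B })
        (card-fibres h Q c B (λ i 1≤i i≤B → fibre i 1≤i (m≤n⇒m≤1+n i≤B)))
        (fibre (suc B) (s≤s z≤n) ≤-refl))
    where
    merge : ∀ x → (1 ≤ h x × h x ≤ B × Q (h x) x) ⊎ (h x ≡ suc B × Q (suc B) x) →
            1 ≤ h x × h x ≤ suc B × Q (h x) x
    merge x (inj₁ (a , b , q)) = a , m≤n⇒m≤1+n b , q
    merge x (inj₂ (e , q)) = subst (λ z → 1 ≤ z × z ≤ suc B × Q z x) (sym e) (s≤s z≤n , ≤-refl , q)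

    split : ∀ x → 1 ≤ h x × h x ≤ suc B × Q (h x) x →
            (1 ≤ h x × h x ≤ B × Q (h x) x) ⊎ (h x ≡ suc B × Q (suc B) x)
    split x (a , b , q) with m≤n⇒m<n∨m≡n b
    ... | inj₁ lt = inj₁ (a , ≤-pred lt , q)
    ... | inj₂ e = inj₂ (e , subst (λ z → Q z x) e q)


module SignedCounts where

  open import Data.Nat as ℕ using (ℕ; zero; suc; _∸_)
  import Data.Nat.Properties as ℕₚ
  open import Data.Nat.Combinatorics using (_C_; nCk+nC[k+1]≡[n+1]C[k+1])
  open import Data.Integer using (ℤ; +_; -[1+_]; _+_; _-_; -_; 0ℤ; _<_; +<+; -<+; +≤+)
  import Data.Integer.Properties as ℤₚ
  open import Data.Integer.Tactic.RingSolver using (solve-∀)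
  open import Data.Bool using (Bool; true; false; not; if_then_else_; T)
  open import Relation.Binary.PropositionalEquality using (_≡_; refl; sym; trans; cong; cong₂; subst)

  -- prefixChoices j m counts the ways to choose i₁ < … < i_{m-1} in [1, j-1], i.e. the
  -- possible beginnings of an m-tuple whose last entry is j (and 0 for m = 0).
  prefixChoices : ℕ → ℕ → ℕ
  prefixChoices j zero = 0
  prefixChoices j (suc m) = (j ∸ 1) C m

  -- Pascal's rule: an (m+1)-prefix below i+2 either avoids i+1 or ends with it.
  prefixChoices-pascal : ∀ i m →
    prefixChoices (suc (suc i)) (suc m) ≡ prefixChoices (suc i) (suc m) ℕ.+ prefixChoices (suc i) m
  prefixChoices-pascal i zero = sym (ℕₚ.+-identityʳ 1)
  prefixChoices-pascal i (suc m) = trans (sym (nCk+nC[k+1]≡[n+1]C[k+1] i m)) (ℕₚ.+-comm (i C m) (i C suc m))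

  -- parityCount j L r b is the number of strictly decreasing lists of elements of [j, j+L)
  -- with sum r whose length is even (b = true) or odd (b = false).  Passing from [j, j+L)
  -- to [j, j+L+1) a list either avoids the new element j+L or starts with it.
  parityCount : ℕ → ℕ → ℕ → Bool → ℕ
  parityCount j zero zero true = 1
  parityCount j zero zero false = 0
  parityCount j zero (suc r) b = 0
  parityCount j (suc L) r b =
    parityCount j L r b ℕ.+ (if (j ℕ.+ L) ℕ.≤ᵇ r then parityCount j L (r ∸ (j ℕ.+ L)) (not b) else 0)

  -- signedCount j L x is the coefficient of q^x in ∏_{j ≤ s < j+L} (1 - q^s):
  -- even-length minus odd-length sets with sum x (zero for negative x).
  signedCount : ℕ → ℕ → ℤ → ℤ
  signedCount j L (+ r) = + parityCount j L r true - + parityCount j L r false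
  signedCount j L -[1+ _ ] = 0ℤ

  signedCount-neg : ∀ j L x → x < 0ℤ → signedCount j L x ≡ 0ℤ
  signedCount-neg j L -[1+ _ ] _ = refl
  signedCount-neg j L (+ _) (+<+ ())

  signedCount-empty : ∀ j j' x → signedCount j 0 x ≡ signedCount j' 0 x
  signedCount-empty j j' (+ zero) = refl
  signedCount-empty j j' (+ suc r) = refl
  signedCount-empty j j' -[1+ r ] = refl

  x-y<0 : ∀ x y → x < y → x - y < 0ℤ
  x-y<0 x y x<y = subst (x - y <_) (ℤₚ.+-inverseʳ y) (ℤₚ.+-monoˡ-< (- y) x<y)

  +-minus-+ : ∀ a b → b ℕ.≤ a → + a - + b ≡ + (a ∸ b)
  +-minus-+ a b b≤a = trans (ℤₚ.m-n≡m⊖n a b) (ℤₚ.⊖-≥ b≤a)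

  minus-+ : ∀ x a b → x - (a + b) ≡ x - a - b
  minus-+ = solve-∀

  -- Splitting off the top factor (1 - q^{j+L}).
  signedCount-top : ∀ j L x → signedCount j (suc L) x ≡ signedCount j L x - signedCount j L (x - + (j ℕ.+ L))
  signedCount-top j L -[1+ n ] =
    sym (cong (λ z → 0ℤ - z) (signedCount-neg j L _ (x-y<0 -[1+ n ] (+ (j ℕ.+ L)) (ℤₚ.<-≤-trans -<+ (+≤+ ℕ.z≤n)))))
  signedCount-top j L (+ r) with (j ℕ.+ L) ℕ.≤ᵇ r in top≤r
  ... | true = begin
      + (D₀ r true ℕ.+ D₀ (r ∸ t) false) - + (D₀ r false ℕ.+ D₀ (r ∸ t) true)
    ≡⟨ cong₂ _-_ (ℤₚ.pos-+ (D₀ r true) _) (ℤₚ.pos-+ (D₀ r false) _) ⟩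
      (+ D₀ r true + + D₀ (r ∸ t) false) - (+ D₀ r false + + D₀ (r ∸ t) true)
    ≡⟨ regroup (+ D₀ r true) (+ D₀ r false) (+ D₀ (r ∸ t) true) (+ D₀ (r ∸ t) false) ⟩
      signedCount j L (+ r) - signedCount j L (+ (r ∸ t))
    ≡⟨ cong (λ z → signedCount j L (+ r) - signedCount j L z) (sym (+-minus-+ r t (ℕₚ.≤ᵇ⇒≤ t r (subst T (sym top≤r) _)))) ⟩
      signedCount j L (+ r) - signedCount j L (+ r - + t)
    ∎
    where
    open Relation.Binary.PropositionalEquality.≡-Reasoning
    t = j ℕ.+ L
    D₀ = parityCount j L
    regroup : ∀ a b c d → (a + d) - (b + c) ≡ (a - b) - (c - d)
    regroup = solve-∀
  ... | false = begin
      + (parityCount j L r true ℕ.+ 0) - + (parityCount j L r false ℕ.+ 0)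
    ≡⟨ cong₂ (λ a b → + a - + b) (ℕₚ.+-identityʳ (parityCount j L r true)) (ℕₚ.+-identityʳ (parityCount j L r false)) ⟩
      signedCount j L (+ r)
    ≡⟨ sym (ℤₚ.+-identityʳ _) ⟩
      signedCount j L (+ r) - 0ℤ
    ≡⟨ cong (λ z → signedCount j L (+ r) - z) (sym (signedCount-neg j L _ (x-y<0 (+ r) (+ t) r<t))) ⟩
      signedCount j L (+ r) - signedCount j L (+ r - + t)
    ∎
    where
    open Relation.Binary.PropositionalEquality.≡-Reasoning
    t = j ℕ.+ L
    r<t : + r < + t
    r<t = +<+ (ℕₚ.≰⇒> (λ t≤r → subst T top≤r (ℕₚ.≤⇒≤ᵇ t≤r)))

  -- Splitting off the bottom factor (1 - q^j) instead, by induction on L.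
  signedCount-bottom : ∀ j L x →
    signedCount j (suc L) x ≡ signedCount (suc j) L x - signedCount (suc j) L (x - + j)
  signedCount-bottom j zero x =
    trans (signedCount-top j 0 x)
      (cong₂ _-_ (signedCount-empty j (suc j) x)
        (trans (cong (λ z → signedCount j 0 (x - + z)) (ℕₚ.+-identityʳ j)) (signedCount-empty j (suc j) (x - + j))))
  signedCount-bottom j (suc L) x = begin
      D j (suc (suc L)) x
    ≡⟨ signedCount-top j (suc L) x ⟩
      D j (suc L) x - D j (suc L) (x - + (j ℕ.+ suc L))
    ≡⟨ cong₂ _-_ (signedCount-bottom j L x) (signedCount-bottom j L (x - + (j ℕ.+ suc L))) ⟩
      (D' x - D' (x - + j)) - (D' (x - + (j ℕ.+ suc L)) - D' (x - + (j ℕ.+ suc L) - + j))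
    ≡⟨ cong (λ a → (D' x - D' (x - + j)) - (D' (x - a) - D' (x - a - + j))) (cong +_ (ℕₚ.+-suc j L)) ⟩
      (D' x - D' (x - + j)) - (D' (x - t) - D' (x - t - + j))
    ≡⟨ cong (λ y → (D' x - D' (x - + j)) - (D' (x - t) - D' y)) (swap x t (+ j)) ⟩
      (D' x - D' (x - + j)) - (D' (x - t) - D' (x - + j - t))
    ≡⟨ regroup (D' x) (D' (x - + j)) (D' (x - t)) (D' (x - + j - t)) ⟩
      (D' x - D' (x - t)) - (D' (x - + j) - D' (x - + j - t))
    ≡⟨ sym (cong₂ _-_ (signedCount-top (suc j) L x) (signedCount-top (suc j) L (x - + j))) ⟩
      D (suc j) (suc L) x - D (suc j) (suc L) (x - + j)
    ∎
    where
    open Relation.Binary.PropositionalEquality.≡-Reasoning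
    D = signedCount
    D' = signedCount (suc j) L
    t = + (suc j ℕ.+ L)
    swap : ∀ x a b → x - a - b ≡ x - b - a
    swap = solve-∀
    regroup : ∀ p q r s → (p - q) - (r - s) ≡ (p - r) - (q - s)
    regroup = solve-∀

  -- A range starting at 0 contains the factor 1 - q^0 = 0.
  signedCount-from-0 : ∀ L x → signedCount 0 (suc L) x ≡ 0ℤ
  signedCount-from-0 L x =
    trans (signedCount-bottom 0 L x)
      (trans (cong (λ z → signedCount 1 L x - signedCount 1 L z) (ℤₚ.+-identityʳ x)) (ℤₚ.+-inverseʳ (signedCount 1 L x)))

  -- With P j L = ∏_{j ≤ s < j+L} (1 - q^s):
  --   P (i+1) (L+1) - q^{L+1} P i (L+1) = (1 - q^{L+1}) P (i+1) L,
  -- obtained by splitting off the top factor on the left and the bottom factor on the right.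
  signedCount-shift : ∀ i L x →
    signedCount (suc i) (suc L) x - signedCount i (suc L) (x - + suc L)
      ≡ signedCount (suc i) L x - signedCount (suc i) L (x - + suc L)
  signedCount-shift i L x = begin
      D (suc i) (suc L) x - D i (suc L) (x - + suc L)
    ≡⟨ cong₂ _-_ (signedCount-top (suc i) L x) (signedCount-bottom i L (x - + suc L)) ⟩
      (D' x - D' (x - + (suc i ℕ.+ L))) - (D' (x - + suc L) - D' (x - + suc L - + i))
    ≡⟨ cong (λ y → (D' x - D' y) - (D' (x - + suc L) - D' (x - + suc L - + i))) top-shift ⟩
      (D' x - D' (x - + suc L - + i)) - (D' (x - + suc L) - D' (x - + suc L - + i))
    ≡⟨ cancel (D' x) (D' (x - + suc L)) (D' (x - + suc L - + i)) ⟩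
      D' x - D' (x - + suc L)
    ∎
    where
    open Relation.Binary.PropositionalEquality.≡-Reasoning
    D = signedCount
    D' = signedCount (suc i) L
    top-shift : x - + (suc i ℕ.+ L) ≡ x - + suc L - + i
    top-shift = trans (cong (λ z → x - + suc z) (ℕₚ.+-comm i L))
                  (trans (cong (λ z → x - z) (ℤₚ.pos-+ (suc L) i)) (minus-+ x (+ suc L) (+ i)))
    cancel : ∀ p q r → (p - r) - (q - r) ≡ p - q
    cancel = solve-∀


module LeftFormula where

  open SignedCounts
  open import Data.Nat as ℕ using (ℕ; zero; suc; _∸_)
  import Data.Nat.Properties as ℕₚ
  import Data.Nat.Tactic.RingSolver as ℕ-Solver
  open import Data.Integer using (ℤ; +_; -[1+_]; _+_; _-_; _*_; ∣_∣; 0ℤ; _<_; _≤_; +<+; -<+; +≤+; -≤+)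
  import Data.Integer.Properties as ℤₚ
  open import Data.Integer.Tactic.RingSolver using (solve-∀)
  open import Relation.Binary.PropositionalEquality using (_≡_; refl; sym; trans; cong; cong₂)
  open Relation.Binary.PropositionalEquality.≡-Reasoning

  sumToℤ : ℕ → (ℕ → ℤ) → ℤ
  sumToℤ zero f = 0ℤ
  sumToℤ (suc B) f = sumToℤ B f + f (suc B)

  sumToℤ-cong : ∀ B (f g : ℕ → ℤ) → (∀ i → i ℕ.< B → f (suc i) ≡ g (suc i)) → sumToℤ B f ≡ sumToℤ B g
  sumToℤ-cong zero f g f≗g = refl
  sumToℤ-cong (suc B) f g f≗g =
    cong₂ _+_ (sumToℤ-cong B f g (λ i i<B → f≗g i (ℕₚ.m≤n⇒m≤1+n i<B))) (f≗g B ℕₚ.≤-refl)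

  sumToℤ-+ : ∀ B (f g : ℕ → ℤ) → sumToℤ B (λ j → f j + g j) ≡ sumToℤ B f + sumToℤ B g
  sumToℤ-+ zero f g = refl
  sumToℤ-+ (suc B) f g =
    trans (cong (_+ (f (suc B) + g (suc B))) (sumToℤ-+ B f g)) (regroup (sumToℤ B f) (sumToℤ B g) (f (suc B)) (g (suc B)))
    where
    regroup : ∀ a b c d → (a + b) + (c + d) ≡ (a + c) + (b + d)
    regroup = solve-∀

  sumToℤ-- : ∀ B (f g : ℕ → ℤ) → sumToℤ B (λ j → f j - g j) ≡ sumToℤ B f - sumToℤ B g
  sumToℤ-- zero f g = refl
  sumToℤ-- (suc B) f g =
    trans (cong (_+ (f (suc B) - g (suc B))) (sumToℤ-- B f g)) (regroup (sumToℤ B f) (sumToℤ B g) (f (suc B)) (g (suc B)))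
    where
    regroup : ∀ a b c d → (a - b) + (c - d) ≡ (a + c) - (b + d)
    regroup = solve-∀

  sumToℤ-shift : ∀ B (f : ℕ → ℤ) → sumToℤ (suc B) f ≡ f 1 + sumToℤ B (λ j → f (suc j))
  sumToℤ-shift zero f = trans (ℤₚ.+-identityˡ (f 1)) (sym (ℤₚ.+-identityʳ (f 1)))
  sumToℤ-shift (suc B) f = trans (cong (_+ f (suc (suc B))) (sumToℤ-shift B f)) (ℤₚ.+-assoc (f 1) _ _)

  sumToℤ-zero : ∀ B (f : ℕ → ℤ) → (∀ i → i ℕ.< B → f (suc i) ≡ 0ℤ) → sumToℤ B f ≡ 0ℤ
  sumToℤ-zero B f f≗0 = trans (sumToℤ-cong B f (λ _ → 0ℤ) f≗0) (zeros B)
    where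
    zeros : ∀ B → sumToℤ B (λ _ → 0ℤ) ≡ 0ℤ
    zeros zero = refl
    zeros (suc B) = cong (_+ 0ℤ) (zeros B)

  sumToℤ-extend : ∀ B (f : ℕ → ℤ) → (∀ j → B ℕ.< j → f j ≡ 0ℤ) → ∀ d → sumToℤ (d ℕ.+ B) f ≡ sumToℤ B f
  sumToℤ-extend B f f≗0 zero = refl
  sumToℤ-extend B f f≗0 (suc d) =
    trans (cong₂ _+_ (sumToℤ-extend B f f≗0 d) (f≗0 (suc (d ℕ.+ B)) (ℕ.s≤s (ℕₚ.m≤n+m B d)))) (ℤₚ.+-identityʳ _)

  minus-minus : ∀ x a b c d → a ℕ.+ b ≡ c ℕ.+ d → x - + a - + b ≡ x - + c - + d
  minus-minus x a b c d a+b≡c+d = begin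
      x - + a - + b        ≡⟨ sym (minus-+ x (+ a) (+ b)) ⟩
      x - (+ a + + b)      ≡⟨ cong (λ z → x - z) (trans (sym (ℤₚ.pos-+ a b)) (trans (cong +_ a+b≡c+d) (ℤₚ.pos-+ c d))) ⟩
      x - (+ c + + d)      ≡⟨ minus-+ x (+ c) (+ d) ⟩
      x - + c - + d        ∎

  *-distribˡ-minus : ∀ c a b → c * a - c * b ≡ c * (a - b)
  *-distribˡ-minus = solve-∀

  -- The j-th term of the left-hand side: the last chosen index is j, so λ₁ = j + k - 1,
  -- the first entries of the tuple are chosen below j, and λ₂ > … > λ_ℓ lie in [j, j+k-1).
  leftTerm : ℕ → ℕ → ℤ → ℕ → ℤ
  leftTerm k m x j = + prefixChoices j m * signedCount j (k ∸ 1) (x - + (j ℕ.+ (k ∸ 1)))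

  -- The signed left-hand side as a function of n (extended by 0 to negative n).
  leftSum : ℕ → ℕ → ℤ → ℤ
  leftSum k m x = sumToℤ ∣ x ∣ (leftTerm k m x)

  leftTerm-vanish : ∀ k m x j → x < + j → leftTerm k m x j ≡ 0ℤ
  leftTerm-vanish k m x j x<j =
    trans (cong (+ prefixChoices j m *_)
            (signedCount-neg j (k ∸ 1) _ (x-y<0 _ _ (ℤₚ.<-≤-trans x<j (+≤+ (ℕₚ.m≤m+n j (k ∸ 1)))))))
          (ℤₚ.*-zeroʳ (+ prefixChoices j m))

  ≤∣∣ : ∀ x → x ≤ + ∣ x ∣
  ≤∣∣ (+ a) = ℤₚ.≤-refl
  ≤∣∣ -[1+ a ] = -≤+

  leftSum-upTo : ∀ k m x B → x ≤ + B → leftSum k m x ≡ sumToℤ B (leftTerm k m x)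
  leftSum-upTo k m -[1+ a ] B _ =
    trans (sumToℤ-zero (suc a) _ (λ i _ → leftTerm-vanish k m -[1+ a ] (suc i) -<+))
          (sym (sumToℤ-zero B _ (λ i _ → leftTerm-vanish k m -[1+ a ] (suc i) -<+)))
  leftSum-upTo k m (+ a) B (+≤+ a≤B) =
    trans (sym (sumToℤ-extend a _ (λ j a<j → leftTerm-vanish k m (+ a) j (+<+ a<j)) (B ∸ a)))
          (cong (λ z → sumToℤ z (leftTerm k m (+ a))) (ℕₚ.m∸n+n≡m a≤B))

  leftSum-neg : ∀ k m x → x < 0ℤ → leftSum k m x ≡ 0ℤ
  leftSum-neg k m x x<0 = leftSum-upTo k m x 0 (ℤₚ.<⇒≤ x<0)

  leftSum-m0 : ∀ k x → leftSum k 0 x ≡ 0ℤ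
  leftSum-m0 k x = sumToℤ-zero ∣ x ∣ (leftTerm k 0 x) (λ i _ → ℤₚ.*-zeroˡ (signedCount (suc i) (k ∸ 1) (x - + (suc i ℕ.+ (k ∸ 1)))))

  x-t≤x : ∀ x t → x - + t ≤ x
  x-t≤x x t = ℤₚ.i≤j⇒i-k≤j (+ t) ℤₚ.≤-refl

  -- The j-th prefix count times the coefficient of q^n in q^{(j+k-1)+(k-1)} P (j-1) (k-1),
  -- where k = L + 2 and P j L = ∏_{j ≤ s < j+L} (1 - q^s).
  shiftedTerm : ℕ → ℕ → ℤ → ℕ → ℤ
  shiftedTerm L M n j = + prefixChoices j M * signedCount (j ∸ 1) (suc L) (n - + (j ℕ.+ suc L) - + suc L)

  -- By Pascal's rule the terms of leftSum k (m+1) (n-k) and leftSum k m (n-k) add up to the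
  -- shifted terms; the shifted term j = 1 vanishes (a range starting at 0).
  shifted-sum : ∀ L m n B →
    let y = n - + suc (suc L) in
    sumToℤ B (λ j → leftTerm (suc (suc L)) (suc m) y j + leftTerm (suc (suc L)) m y j) ≡ sumToℤ (suc B) (shiftedTerm L (suc m) n)
  shifted-sum L m n B = begin
      sumToℤ B (λ j → leftTerm k M y j + leftTerm k m y j)
    ≡⟨ sumToℤ-cong B _ _ (λ i _ → pascal i) ⟩
      sumToℤ B (λ j → T (suc j))
    ≡⟨ sym (ℤₚ.+-identityˡ _) ⟩
      0ℤ + sumToℤ B (λ j → T (suc j))
    ≡⟨ cong (_+ sumToℤ B (λ j → T (suc j))) (sym first-vanishes) ⟩
      T 1 + sumToℤ B (λ j → T (suc j))
    ≡⟨ sym (sumToℤ-shift B T) ⟩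
      sumToℤ (suc B) T
    ∎
    where
    k = suc (suc L)
    M = suc m
    y = n - + k
    T = shiftedTerm L M n
    first-vanishes : T 1 ≡ 0ℤ
    first-vanishes = trans (cong (+ prefixChoices 1 M *_) (signedCount-from-0 L (n - + (1 ℕ.+ suc L) - + suc L)))
                           (ℤₚ.*-zeroʳ (+ prefixChoices 1 M))
    pascal : ∀ i → leftTerm k M y (suc i) + leftTerm k m y (suc i) ≡ T (suc (suc i))
    pascal i = begin
        + c M * D + + c m * D
      ≡⟨ sym (ℤₚ.*-distribʳ-+ D (+ c M) (+ c m)) ⟩
        (+ c M + + c m) * D
      ≡⟨ cong₂ _*_ (trans (sym (ℤₚ.pos-+ (c M) (c m))) (cong +_ (sym (prefixChoices-pascal i m))))
                   (cong (signedCount (suc i) (suc L)) (minus-minus n k (suc i ℕ.+ suc L) (suc (suc i) ℕ.+ suc L) (suc L) (lengths i L))) ⟩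
        T (suc (suc i))
      ∎
      where
      c = prefixChoices (suc i)
      D = signedCount (suc i) (suc L) (y - + (suc i ℕ.+ suc L))
      lengths : ∀ i L → suc (suc L) ℕ.+ (suc i ℕ.+ suc L) ≡ suc (suc i) ℕ.+ suc L ℕ.+ suc L
      lengths = ℕ-Solver.solve-∀

  -- Termwise, leftTerm k M n j minus the shifted term is the difference of two terms for k-1,
  -- by the product identity signedCount-shift.
  shifted-cancel : ∀ L M n i →
    leftTerm (suc (suc L)) M n (suc i) - shiftedTerm L M n (suc i)
      ≡ leftTerm (suc L) M (n - + 1) (suc i) - leftTerm (suc L) M (n - + suc (suc L)) (suc i)
  shifted-cancel L M n i = begin
      c * signedCount (suc i) (suc L) r - c * signedCount i (suc L) (r - + suc L)
    ≡⟨ *-distribˡ-minus c _ _ ⟩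
      c * (signedCount (suc i) (suc L) r - signedCount i (suc L) (r - + suc L))
    ≡⟨ cong (c *_) (signedCount-shift i L r) ⟩
      c * (signedCount (suc i) L r - signedCount (suc i) L (r - + suc L))
    ≡⟨ cong₂ (λ a b → c * (signedCount (suc i) L a - signedCount (suc i) L b)) r≡ r-1-L≡ ⟩
      c * (signedCount (suc i) L (n - + 1 - + (suc i ℕ.+ L)) - signedCount (suc i) L (n - + suc (suc L) - + (suc i ℕ.+ L)))
    ≡⟨ sym (*-distribˡ-minus c _ _) ⟩
      leftTerm (suc L) M (n - + 1) (suc i) - leftTerm (suc L) M (n - + suc (suc L)) (suc i)
    ∎
    where
    c = + prefixChoices (suc i) M
    r = n - + (suc i ℕ.+ suc L)
    r≡ : r ≡ n - + 1 - + (suc i ℕ.+ L)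
    r≡ = trans (cong (λ z → n - z) (trans (cong +_ (ℕₚ.+-suc (suc i) L)) (ℤₚ.pos-+ 1 (suc i ℕ.+ L)))) (minus-+ n (+ 1) _)
    r-1-L≡ : r - + suc L ≡ n - + suc (suc L) - + (suc i ℕ.+ L)
    r-1-L≡ = minus-minus n _ _ (suc (suc L)) _ (lengths i L)
      where
      lengths : ∀ i L → suc i ℕ.+ suc L ℕ.+ suc L ≡ suc (suc L) ℕ.+ (suc i ℕ.+ L)
      lengths = ℕ-Solver.solve-∀

  leftSum-recursion : ∀ L m n →
    leftSum (suc (suc L)) (suc m) n - leftSum (suc (suc L)) (suc m) (n - + suc (suc L))
      - leftSum (suc (suc L)) m (n - + suc (suc L))
    ≡ leftSum (suc L) (suc m) (n - + 1) - leftSum (suc L) (suc m) (n - + suc (suc L))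
  leftSum-recursion L m n = begin
      leftSum k M n - leftSum k M y - leftSum k m y
    ≡⟨ cong₂ (λ a b → a - b - leftSum k m y) (leftSum-upTo k M n (suc B) n≤1+B) (leftSum-upTo k M y B y≤B) ⟩
      S - sumToℤ B (leftTerm k M y) - leftSum k m y
    ≡⟨ cong (λ a → S - sumToℤ B (leftTerm k M y) - a) (leftSum-upTo k m y B y≤B) ⟩
      S - sumToℤ B (leftTerm k M y) - sumToℤ B (leftTerm k m y)
    ≡⟨ trans (sym (minus-+ S _ _)) (cong (λ z → S - z) (sym (sumToℤ-+ B _ _))) ⟩
      S - sumToℤ B (λ j → leftTerm k M y j + leftTerm k m y j)
    ≡⟨ cong (λ z → S - z) (shifted-sum L m n B) ⟩
      S - sumToℤ (suc B) (shiftedTerm L M n)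
    ≡⟨ sym (sumToℤ-- (suc B) _ _) ⟩
      sumToℤ (suc B) (λ j → leftTerm k M n j - shiftedTerm L M n j)
    ≡⟨ sumToℤ-cong (suc B) _ _ (λ i _ → shifted-cancel L M n i) ⟩
      sumToℤ (suc B) (λ j → leftTerm (suc L) M (n - + 1) j - leftTerm (suc L) M y j)
    ≡⟨ sumToℤ-- (suc B) _ _ ⟩
      sumToℤ (suc B) (leftTerm (suc L) M (n - + 1)) - sumToℤ (suc B) (leftTerm (suc L) M y)
    ≡⟨ sym (cong₂ _-_ (leftSum-upTo (suc L) M (n - + 1) (suc B) (ℤₚ.≤-trans (x-t≤x n 1) n≤1+B))
                       (leftSum-upTo (suc L) M y (suc B) (ℤₚ.≤-trans y≤B (+≤+ (ℕₚ.n≤1+n B))))) ⟩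
      leftSum (suc L) M (n - + 1) - leftSum (suc L) M y
    ∎
    where
    k = suc (suc L)
    M = suc m
    y = n - + k
    B = ∣ n ∣
    S = sumToℤ (suc B) (leftTerm k M n)
    n≤1+B : n ≤ + suc B
    n≤1+B = ℤₚ.≤-trans (≤∣∣ n) (+≤+ (ℕₚ.n≤1+n B))
    y≤B : y ≤ + B
    y≤B = ℤₚ.≤-trans (x-t≤x n k) (≤∣∣ n)


module FirstRowRecursion where

  open Counting using (sumTo)
  open SignedCounts
  open LeftFormula
  open import Data.Nat as ℕ using (ℕ; zero; suc; _∸_)
  import Data.Nat.Properties as ℕₚ
  import Data.Nat.Tactic.RingSolver as ℕ-Solver
  open import Data.Integer using (ℤ; +_; -[1+_]; _+_; _-_; _*_; ∣_∣; 0ℤ; _<_; _≤_; +<+; -<+; +≤+; -≤+)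
  import Data.Integer.Properties as ℤₚ
  open import Data.Integer.Tactic.RingSolver using (solve-∀)
  open import Data.Product using (_,_)
  open import Relation.Nullary using (yes; no)
  open import Relation.Binary.PropositionalEquality using (_≡_; refl; sym; trans; cong; cong₂; subst)
  open Relation.Binary.PropositionalEquality.≡-Reasoning

  -- Removing the first row k from a partition of k + d leaves either nothing (d = 0, and then
  -- the single corner forces m = 1) …
  onlyRow : ℕ → ℕ → ℕ
  onlyRow zero (suc zero) = 1
  onlyRow _ _ = 0

  onlyRow-m0 : ∀ d → onlyRow d 0 ≡ 0
  onlyRow-m0 zero = refl
  onlyRow-m0 (suc d) = refl

  -- … or a partition of d whose first row is again k (counted by R k m d when 1 is not among
  -- the tᵢ, by R k (m-1) d when it is), or one whose first row h is smaller, in which case the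
  -- first row is a new corner: R h (m-1) d.  oneLess collects the contributions with m-1.
  oneLess : (ℕ → ℕ → ℕ → ℕ) → ℕ → ℕ → ℕ → ℕ
  oneLess R k zero d = 0
  oneLess R k (suc m) d = R k m d ℕ.+ sumTo (k ∸ 1) (λ h → R h m d)

  firstRowSum : (ℕ → ℕ → ℕ → ℕ) → ℕ → ℕ → ℕ → ℕ
  firstRowSum R k m d = onlyRow d m ℕ.+ R k m d ℕ.+ oneLess R k m d

  difference-of-sums : ∀ a b c p q → a ℕ.+ b ≡ c ℕ.+ p ℕ.+ q → + a - + p - + q ≡ + c - + b
  difference-of-sums a b c p q a+b≡c+p+q = begin
      + a - + p - + q
    ≡⟨ add-and-remove (+ a) (+ b) (+ p) (+ q) ⟩
      (+ a + + b) - + p - + q - + b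
    ≡⟨ cong (λ z → z - + p - + q - + b) in-ℤ ⟩
      (+ c + + p + + q) - + p - + q - + b
    ≡⟨ cancel (+ c) (+ b) (+ p) (+ q) ⟩
      + c - + b
    ∎
    where
    in-ℤ : + a + + b ≡ + c + + p + + q
    in-ℤ = trans (sym (ℤₚ.pos-+ a b))
             (trans (cong +_ a+b≡c+p+q) (trans (ℤₚ.pos-+ (c ℕ.+ p) q) (cong (_+ + q) (ℤₚ.pos-+ c p))))
    add-and-remove : ∀ a b p q → a - p - q ≡ (a + b) - p - q - b
    add-and-remove = solve-∀
    cancel : ∀ c b p q → (c + p + q) - p - q - b ≡ c - b
    cancel = solve-∀

  solve-for-first : ∀ a b c d → a - b - c ≡ d → a ≡ b + c + d
  solve-for-first a b c d e = trans (rearrange a b c) (cong (λ z → b + c + z) e)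
    where
    rearrange : ∀ a b c → a ≡ b + c + (a - b - c)
    rearrange = solve-∀

  x-k<x : ∀ x t → x - + suc t < x
  x-k<x x t = subst (x - + suc t <_) (ℤₚ.+-identityʳ x) (ℤₚ.+-monoʳ-< x -<+)

  x<1+b⇒x≤b : ∀ x b → x < + suc b → x ≤ + b
  x<1+b⇒x≤b (+ n) b (+<+ (ℕ.s≤s n≤b)) = +≤+ n≤b
  x<1+b⇒x≤b -[1+ n ] b _ = -≤+

  -- Any R satisfying the first-row recursion coincides with the left-hand side formula:
  -- both are determined by the recursion in k and n, which leftSum-recursion shows for leftSum.
  module Uniqueness (R : ℕ → ℕ → ℕ → ℕ)
    (R-small : ∀ k m n → 1 ℕ.≤ k → n ℕ.< k → R k m n ≡ 0)
    (R-step : ∀ k m d → 1 ℕ.≤ k → R k m (k ℕ.+ d) ≡ firstRowSum R k m d) where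

    Rℤ : ℕ → ℕ → ℤ → ℤ
    Rℤ k m (+ n) = + R k m n
    Rℤ k m -[1+ _ ] = 0ℤ

    Rℤ-neg : ∀ k m x → x < 0ℤ → Rℤ k m x ≡ 0ℤ
    Rℤ-neg k m -[1+ _ ] _ = refl
    Rℤ-neg k m (+ _) (+<+ ())

    -- The recursion forces R k 0 n = 0: every partition has a corner.
    R-m0 : ∀ k n → 1 ℕ.≤ k → R k 0 n ≡ 0
    R-m0 k n 1≤k = go (suc n) n ℕₚ.≤-refl
      where
      go : ∀ fuel n → n ℕ.< fuel → R k 0 n ≡ 0
      go (suc fuel) n n<fuel with k ℕₚ.≤? n
      ... | no n≱k = R-small k 0 n 1≤k (ℕₚ.≰⇒> n≱k)
      ... | yes k≤n = begin
          R k 0 n                                         ≡⟨ cong (R k 0) (sym (ℕₚ.m+[n∸m]≡n k≤n)) ⟩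
          R k 0 (k ℕ.+ d)                                 ≡⟨ R-step k 0 d 1≤k ⟩
          onlyRow d 0 ℕ.+ R k 0 d ℕ.+ 0                  ≡⟨ cong₂ (λ a b → a ℕ.+ b ℕ.+ 0) (onlyRow-m0 d) (go fuel d d<fuel) ⟩
          0                                               ∎
        where
        d = n ∸ k
        d<fuel : d ℕ.< fuel
        d<fuel = ℕₚ.≤-trans (ℕₚ.∸-monoʳ-< 1≤k k≤n) (ℕₚ.≤-pred n<fuel)

    Rℤ-m0 : ∀ k x → 1 ℕ.≤ k → Rℤ k 0 x ≡ 0ℤ
    Rℤ-m0 k (+ n) 1≤k = cong +_ (R-m0 k n 1≤k)
    Rℤ-m0 k -[1+ _ ] 1≤k = refl

    -- Both first-row recursions, for k = L+2 and for k-1, contain onlyRow d (m+1) and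
    -- Σ_{h ≤ L+1} R h m d; comparing them gives an identity between natural numbers.
    first-row-exchange : ∀ L m d →
      R (suc (suc L)) (suc m) (suc (suc L) ℕ.+ d) ℕ.+ R (suc L) (suc m) d
        ≡ R (suc L) (suc m) (suc L ℕ.+ d) ℕ.+ R (suc (suc L)) (suc m) d ℕ.+ R (suc (suc L)) m d
    first-row-exchange L m d = begin
        R k M (k ℕ.+ d) ℕ.+ R (suc L) M d
      ≡⟨ cong (ℕ._+ R (suc L) M d) (R-step k M d (ℕ.s≤s ℕ.z≤n)) ⟩
        onlyRow d M ℕ.+ R k M d ℕ.+ (R k m d ℕ.+ (sumTo L (λ h → R h m d) ℕ.+ R (suc L) m d)) ℕ.+ R (suc L) M d
      ≡⟨ shuffle (onlyRow d M) (R k M d) (R k m d) (sumTo L (λ h → R h m d)) (R (suc L) m d) (R (suc L) M d) ⟩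
        onlyRow d M ℕ.+ R (suc L) M d ℕ.+ (R (suc L) m d ℕ.+ sumTo L (λ h → R h m d)) ℕ.+ R k M d ℕ.+ R k m d
      ≡⟨ cong (λ z → z ℕ.+ R k M d ℕ.+ R k m d) (sym (R-step (suc L) M d (ℕ.s≤s ℕ.z≤n))) ⟩
        R (suc L) M (suc L ℕ.+ d) ℕ.+ R k M d ℕ.+ R k m d
      ∎
      where
      k = suc (suc L)
      M = suc m
      shuffle : ∀ δ A C S E F → δ ℕ.+ A ℕ.+ (C ℕ.+ (S ℕ.+ E)) ℕ.+ F ≡ δ ℕ.+ F ℕ.+ (E ℕ.+ S) ℕ.+ A ℕ.+ C
      shuffle = ℕ-Solver.solve-∀

    -- Rℤ obeys the same recursion as leftSum (compare leftSum-recursion): both sides equal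
    -- onlyRow d (m+1) + Σ_{h ≤ k-1} R h m d when n = k + d, and vanish when n < k.
    Rℤ-recursion : ∀ L m x →
      Rℤ (suc (suc L)) (suc m) x - Rℤ (suc (suc L)) (suc m) (x - + suc (suc L)) - Rℤ (suc (suc L)) m (x - + suc (suc L))
        ≡ Rℤ (suc L) (suc m) (x - + 1) - Rℤ (suc L) (suc m) (x - + suc (suc L))
    Rℤ-recursion L m -[1+ a ] =
      trans (cong₂ (λ p q → 0ℤ - p - q) (Rℤ-neg k (suc m) _ (below -[1+ a ] k -<+)) (Rℤ-neg k m _ (below -[1+ a ] k -<+)))
            (sym (cong₂ _-_ (Rℤ-neg (suc L) (suc m) _ (below -[1+ a ] 1 -<+)) (Rℤ-neg (suc L) (suc m) _ (below -[1+ a ] k -<+))))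
      where
      k = suc (suc L)
      below : ∀ x t → x < 0ℤ → x - + t < 0ℤ
      below x t x<0 = ℤₚ.≤-<-trans (x-t≤x x t) x<0
    Rℤ-recursion L m (+ n) with suc (suc L) ℕₚ.≤? n
    ... | no n≱k =
      trans (cong₂ (λ p q → p - q - Rℤ k m (+ n - + k)) (cong +_ (R-small _ _ _ (ℕ.s≤s ℕ.z≤n) n<k)) (Rℤ-neg _ _ _ n-k<0))
       (trans (cong (λ q → 0ℤ - 0ℤ - q) (Rℤ-neg _ _ _ n-k<0))
         (sym (cong₂ _-_ (n-1-small n n<k) (Rℤ-neg _ _ _ n-k<0))))
      where
      k = suc (suc L)
      n<k = ℕₚ.≰⇒> n≱k
      n-k<0 : + n - + k < 0ℤ
      n-k<0 = x-y<0 (+ n) (+ k) (+<+ n<k)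
      n-1-small : ∀ n → n ℕ.< k → Rℤ (suc L) (suc m) (+ n - + 1) ≡ 0ℤ
      n-1-small zero _ = refl
      n-1-small (suc n) (ℕ.s≤s n<1+L) =
        trans (cong (Rℤ (suc L) (suc m)) (+-minus-+ (suc n) 1 (ℕ.s≤s ℕ.z≤n))) (cong +_ (R-small _ _ _ (ℕ.s≤s ℕ.z≤n) n<1+L))
    ... | yes k≤n rewrite sym (ℕₚ.m+[n∸m]≡n k≤n) = begin
        Rℤ k M (+ (k ℕ.+ d)) - Rℤ k M (+ (k ℕ.+ d) - + k) - Rℤ k m (+ (k ℕ.+ d) - + k)
      ≡⟨ cong₂ (λ p q → Rℤ k M (+ (k ℕ.+ d)) - Rℤ k M p - Rℤ k m q) (k+d-k k) (k+d-k k) ⟩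
        + R k M (k ℕ.+ d) - + R k M d - + R k m d
      ≡⟨ difference-of-sums _ (R (suc L) M d) _ (R k M d) (R k m d) (first-row-exchange L m d) ⟩
        + R (suc L) M (suc L ℕ.+ d) - + R (suc L) M d
      ≡⟨ sym (cong₂ (λ p q → Rℤ (suc L) M p - Rℤ (suc L) M q) k+d-1 (k+d-k k)) ⟩
        Rℤ (suc L) M (+ (k ℕ.+ d) - + 1) - Rℤ (suc L) M (+ (k ℕ.+ d) - + k)
      ∎
      where
      k = suc (suc L)
      M = suc m
      d = n ∸ k
      k+d-k : ∀ k → + (k ℕ.+ d) - + k ≡ + d
      k+d-k k = trans (+-minus-+ (k ℕ.+ d) k (ℕₚ.m≤m+n k d)) (cong +_ (ℕₚ.m+n∸m≡n k d))
      k+d-1 : + (k ℕ.+ d) - + 1 ≡ + (suc L ℕ.+ d)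
      k+d-1 = +-minus-+ (k ℕ.+ d) 1 (ℕ.s≤s ℕ.z≤n)

    -- For k = 1 both sides count the choices of the prefix below the single part.
    R-one : ∀ m d → R 1 m (suc d) ≡ prefixChoices (suc d) m
    R-one m zero = trans (R-step 1 m 0 ℕₚ.≤-refl) (single m)
      where
      R1-0 : ∀ m → R 1 m 0 ≡ 0
      R1-0 m = R-small 1 m 0 ℕₚ.≤-refl (ℕ.s≤s ℕ.z≤n)
      single : ∀ m → onlyRow 0 m ℕ.+ R 1 m 0 ℕ.+ oneLess R 1 m 0 ≡ prefixChoices 1 m
      single zero = trans (ℕₚ.+-identityʳ _) (R1-0 0)
      single (suc m) rewrite R1-0 (suc m) | R1-0 m with m
      ... | zero = refl
      ... | suc _ = refl
    R-one zero (suc d) = trans (R-step 1 0 (suc d) ℕₚ.≤-refl) (trans (ℕₚ.+-identityʳ _) (R-one 0 d))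
    R-one (suc m) (suc d) = begin
        R 1 (suc m) (suc (suc d))
      ≡⟨ R-step 1 (suc m) (suc d) ℕₚ.≤-refl ⟩
        R 1 (suc m) (suc d) ℕ.+ (R 1 m (suc d) ℕ.+ 0)
      ≡⟨ cong₂ ℕ._+_ (R-one (suc m) d) (trans (ℕₚ.+-identityʳ _) (R-one m d)) ⟩
        prefixChoices (suc d) (suc m) ℕ.+ prefixChoices (suc d) m
      ≡⟨ sym (prefixChoices-pascal d m) ⟩
        prefixChoices (suc (suc d)) (suc m)
      ∎

    leftSum-one : ∀ m x → leftSum 1 m x ≡ Rℤ 1 m x
    leftSum-one m -[1+ a ] = leftSum-neg 1 m -[1+ a ] -<+
    leftSum-one m (+ zero) = sym (cong +_ (R-small 1 m 0 ℕₚ.≤-refl (ℕ.s≤s ℕ.z≤n)))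
    leftSum-one m (+ suc d) =
      trans (cong₂ _+_ (sumToℤ-zero d _ early) last) (trans (ℤₚ.+-identityˡ _) (cong +_ (sym (R-one m d))))
      where
      -- only the term j = d+1, for which λ₁ = j exhausts n, survives
      early : ∀ i → i ℕ.< d → leftTerm 1 m (+ suc d) (suc i) ≡ 0ℤ
      early i i<d = begin
          + prefixChoices (suc i) m * signedCount (suc i) 0 (+ suc d - + (suc i ℕ.+ 0))
        ≡⟨ cong (λ w → + prefixChoices (suc i) m * signedCount (suc i) 0 (+ suc d - + w)) (ℕₚ.+-identityʳ (suc i)) ⟩
          + prefixChoices (suc i) m * signedCount (suc i) 0 (+ suc d - + suc i)
        ≡⟨ cong (λ w → + prefixChoices (suc i) m * signedCount (suc i) 0 w) (+-minus-+ (suc d) (suc i) (ℕ.s≤s (ℕₚ.<⇒≤ i<d))) ⟩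
          + prefixChoices (suc i) m * signedCount (suc i) 0 (+ (d ∸ i))
        ≡⟨ cong (λ w → + prefixChoices (suc i) m * signedCount (suc i) 0 (+ w)) (ℕₚ.+-∸-assoc 1 i<d) ⟩
          + prefixChoices (suc i) m * 0ℤ
        ≡⟨ ℤₚ.*-zeroʳ (+ prefixChoices (suc i) m) ⟩
          0ℤ
        ∎
      last : leftTerm 1 m (+ suc d) (suc d) ≡ + prefixChoices (suc d) m
      last = trans (cong (λ w → + prefixChoices (suc d) m * signedCount (suc d) 0 w)
                     (trans (cong (λ w → + suc d - + w) (ℕₚ.+-identityʳ (suc d))) (ℤₚ.+-inverseʳ (+ suc d))))
                   (ℤₚ.*-identityʳ _)

    leftSum≡Rℤ : ∀ k m x → leftSum (suc k) m x ≡ Rℤ (suc k) m x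
    leftSum≡Rℤ zero = leftSum-one
    leftSum≡Rℤ (suc L) m x = go (suc ∣ x ∣) m x (ℤₚ.≤-<-trans (≤∣∣ x) (+<+ ℕₚ.≤-refl))
      where
      k = suc (suc L)
      go : ∀ bound m x → x < + bound → leftSum k m x ≡ Rℤ k m x
      go zero m x x<0 = trans (leftSum-neg k m x x<0) (sym (Rℤ-neg k m x x<0))
      go (suc bound) zero x _ = trans (leftSum-m0 k x) (sym (Rℤ-m0 k x (ℕ.s≤s ℕ.z≤n)))
      go (suc bound) (suc m) x x<1+bound = begin
          leftSum k M x
        ≡⟨ solve-for-first _ _ _ _ (leftSum-recursion L m x) ⟩
          leftSum k M y + leftSum k m y + (leftSum (suc L) M (x - + 1) - leftSum (suc L) M y)
        ≡⟨ cong₂ _+_ (cong₂ _+_ (go bound M y y<bound) (go bound m y y<bound))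
                     (cong₂ _-_ (leftSum≡Rℤ L M (x - + 1)) (leftSum≡Rℤ L M y)) ⟩
          Rℤ k M y + Rℤ k m y + (Rℤ (suc L) M (x - + 1) - Rℤ (suc L) M y)
        ≡⟨ sym (solve-for-first _ _ _ _ (Rℤ-recursion L m x)) ⟩
          Rℤ k M x
        ∎
        where
        M = suc m
        y = x - + k
        y<bound : y < + bound
        y<bound = ℤₚ.<-≤-trans (x-k<x x (suc L)) (x<1+b⇒x≤b x bound x<1+bound)


module RightCount where

  open import Defs
  open Counting
  open FirstRowRecursion using (onlyRow; onlyRow-m0; firstRowSum)
  open import Data.Nat using (ℕ; zero; suc; _+_; _∸_; _≤_; _<_; z≤n; s≤s; pred; _≤ᵇ_)
  open import Data.Nat.Properties
  open import Data.Bool using (true; false; if_then_else_; T)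
  open import Data.List using (List; []; _∷_; length; map; drop)
  open import Data.List.Properties using (length-map)
  open import Data.List.Relation.Unary.All as All using (All; []; _∷_)
  open import Data.List.Relation.Unary.Linked as Linked using (Linked; []; [-]; _∷_)
  import Data.List.Relation.Unary.Linked.Properties as Linkedₚ
  open import Data.Product using (_×_; _,_; proj₁; proj₂)
  open import Data.Sum using (_⊎_; inj₁; inj₂)
  open import Data.Empty using (⊥; ⊥-elim)
  open import Relation.Nullary using (yes; no)
  open import Relation.Binary.PropositionalEquality using (_≡_; _≢_; refl; sym; trans; cong; cong₂; subst)

  RepeatPositions : List ℕ → List ℕ → Set
  RepeatPositions lam ts = All (λ t → 1 ≤ t × t < length lam × part lam t ≡ part lam (suc t)) ts

  -- Adding a first row k on top of (λ, t); the marked version also records the new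
  -- repetition at position 1.  removeRow and removeRowMarked are their left inverses.
  addRow addRowMarked : ℕ → List ℕ × List ℕ → List ℕ × List ℕ
  addRow k (lam , ts) = (k ∷ lam , map suc ts)
  addRowMarked k (lam , ts) = (k ∷ lam , 1 ∷ map suc ts)

  removeRow removeRowMarked : List ℕ × List ℕ → List ℕ × List ℕ
  removeRow (lam , ts) = (drop 1 lam , map pred ts)
  removeRowMarked (lam , ts) = (drop 1 lam , map pred (drop 1 ts))

  pred∘suc : ∀ ts → map pred (map suc ts) ≡ ts
  pred∘suc [] = refl
  pred∘suc (t ∷ ts) = cong (t ∷_) (pred∘suc ts)

  suc∘pred : ∀ ts → All (1 ≤_) ts → map suc (map pred ts) ≡ ts
  suc∘pred [] [] = refl
  suc∘pred (suc t ∷ ts) (s≤s _ ∷ ps) = cong (suc t ∷_) (suc∘pred ts ps)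

  removeRow∘addRow : ∀ k y → removeRow (addRow k y) ≡ y
  removeRow∘addRow k (lam , ts) = cong (lam ,_) (pred∘suc ts)

  removeRowMarked∘addRowMarked : ∀ k y → removeRowMarked (addRowMarked k y) ≡ y
  removeRowMarked∘addRowMarked k (lam , ts) = cong (lam ,_) (pred∘suc ts)

  corners-repeat : ∀ k r → corners (k ∷ k ∷ r) ≡ corners (k ∷ r)
  corners-repeat k r with k ≟ k
  ... | yes _ = refl
  ... | no k≢k = ⊥-elim (k≢k refl)

  corners-new : ∀ k y r → k ≢ y → corners (k ∷ y ∷ r) ≡ suc (corners (y ∷ r))
  corners-new k y r k≢y with k ≟ y
  ... | yes k≡y = ⊥-elim (k≢y k≡y)
  ... | no _ = refl

  corners-positive : ∀ x r → 1 ≤ corners (x ∷ r)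
  corners-positive x [] = ≤-refl
  corners-positive x (y ∷ r) = ≤-trans (corners-positive y r) (m≤n+m _ _)

  shift-up : ∀ x lam ts → RepeatPositions lam ts → RepeatPositions (x ∷ lam) (map suc ts)
  shift-up x lam [] [] = []
  shift-up x lam (suc t ∷ ts) ((_ , t<ℓ , same) ∷ ps) = (s≤s z≤n , s≤s t<ℓ , same) ∷ shift-up x lam ts ps

  shift-down : ∀ x lam ts → All (2 ≤_) ts → RepeatPositions (x ∷ lam) ts → RepeatPositions lam (map pred ts)
  shift-down x lam [] [] [] = []
  shift-down x lam (suc zero ∷ ts) (s≤s () ∷ _) _
  shift-down x lam (suc (suc t) ∷ ts) (_ ∷ ge) ((_ , t<ℓ , same) ∷ ps) =
    (s≤s z≤n , ≤-pred t<ℓ , same) ∷ shift-down x lam ts ge ps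

  position-0 : ∀ {lam ts} → RepeatPositions lam (0 ∷ ts) → ⊥
  position-0 ((() , _) ∷ _)

  positions-positive : ∀ {lam} ts → RepeatPositions lam ts → All (1 ≤_) ts
  positions-positive [] [] = []
  positions-positive {lam} (t ∷ ts) ((1≤t , _) ∷ ps) = 1≤t ∷ positions-positive {lam} ts ps

  increasing-up : ∀ ts → Linked _<_ ts → Linked _<_ (map suc ts)
  increasing-up ts inc = Linkedₚ.map⁺ (Linked.map s≤s inc)

  increasing-down : ∀ ts → All (1 ≤_) ts → Linked _<_ ts → Linked _<_ (map pred ts)
  increasing-down ts ps inc = Linkedₚ.map⁺ (go ts ps inc)
    where
    go : ∀ ts → All (1 ≤_) ts → Linked _<_ ts → Linked (λ a b → pred a < pred b) ts
    go [] _ [] = []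
    go (_ ∷ []) _ [-] = [-]
    go (suc a ∷ b ∷ ts) (_ ∷ ps) (a<b ∷ inc) = <⇒≤pred a<b ∷ go (b ∷ ts) ps inc

  above : ∀ v ts → Linked _<_ (v ∷ ts) → All (v <_) ts
  above v [] _ = []
  above v (t ∷ ts) (v<t ∷ inc) = Linkedₚ.Linked⇒All <-trans v<t inc

  at-least-2 : ∀ v ts → 1 ≤ v → All (v <_) ts → All (2 ≤_) ts
  at-least-2 v [] _ [] = []
  at-least-2 v (t ∷ ts) 1≤v (v<t ∷ ps) = ≤-trans (s≤s 1≤v) v<t ∷ at-least-2 v ts 1≤v ps

  no-position-1 : ∀ x lam ts → x ≢ part lam 1 → RepeatPositions (x ∷ lam) ts → All (2 ≤_) ts
  no-position-1 x lam [] x≢ [] = []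
  no-position-1 x lam (suc zero ∷ ts) x≢ ((_ , _ , same) ∷ ps) = ⊥-elim (x≢ same)
  no-position-1 x lam (suc (suc t) ∷ ts) x≢ (_ ∷ ps) = s≤s (s≤s z≤n) ∷ no-position-1 x lam ts x≢ ps

  first-row≤size : ∀ n lam → IsPartition n lam → part lam 1 ≤ n
  first-row≤size n [] _ = z≤n
  first-row≤size n (x ∷ r) (_ , _ , sum≡n) = subst (x ≤_) sum≡n (m≤m+n x _)

  no-tuple-m0 : ∀ k n y → 1 ≤ k → RightTuple k 0 n y → ⊥
  no-tuple-m0 k n ([] , ts) 1≤k (_ , first≡k , _) = <⇒≢ 1≤k first≡k
  no-tuple-m0 k n (x ∷ r , ts) 1≤k (_ , _ , _ , count , _) =
    <⇒≢ (≤-trans (corners-positive x r) (m≤n+m _ (length ts))) (sym count)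

  ≤-pred′ : ∀ {y x} → y < x → y ≤ x ∸ 1
  ≤-pred′ {x = suc x} (s≤s y≤x) = y≤x

  remove-first-row : ∀ {d m} x lam ts → IsPartition d lam → All (2 ≤_) ts → Linked _<_ ts →
    RepeatPositions (x ∷ lam) ts → length ts + corners lam ≡ m →
    RightTuple (part lam 1) m d (lam , map pred ts) × map suc (map pred ts) ≡ ts
  remove-first-row x lam ts partition ge2 inc ps count =
    (partition , refl , ≤-trans (m≤n+m _ (length ts)) (≤-reflexive count) ,
     trans (cong (_+ corners lam) (length-map pred ts)) count ,
     increasing-down ts ge1 inc , shift-down x lam ts ge2 ps) ,
    suc∘pred ts ge1
    where
    ge1 = positions-positive {x ∷ lam} ts ps

  -- The four ways a right tuple of size k + d with first row k arises (for m = m'+1).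
  module FirstRow (k m' d : ℕ) (1≤k : 1 ≤ k) where

    Single : List ℕ × List ℕ → Set
    Single y = y ≡ (k ∷ [] , []) × d ≡ 0 × m' ≡ 0

    -- λ₂ = k and position 1 is not chosen.
    Repeated : List ℕ × List ℕ → Set
    Repeated y = RightTuple k (suc m') d (removeRow y) × addRow k (removeRow y) ≡ y

    -- λ₂ = k and position 1 is chosen.
    RepeatedMarked : List ℕ × List ℕ → Set
    RepeatedMarked y = RightTuple k m' d (removeRowMarked y) × addRowMarked k (removeRowMarked y) ≡ y

    -- λ₂ = h < k: the first row is a new corner.
    StartsBelow : List ℕ × List ℕ → Set
    StartsBelow x = 1 ≤ part (proj₁ x) 1 × part (proj₁ x) 1 ≤ k ∸ 1 × RightTuple (part (proj₁ x) 1) m' d x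

    Smaller : List ℕ × List ℕ → Set
    Smaller y = StartsBelow (removeRow y) × addRow k (removeRow y) ≡ y

    Cases : List ℕ × List ℕ → Set
    Cases y = Single y ⊎ Repeated y ⊎ RepeatedMarked y ⊎ Smaller y

    private
      RT = RightTuple k (suc m') (k + d)

      k≰k-1 : k ≤ k ∸ 1 → ⊥
      k≰k-1 = <⇒≱ (∸-monoʳ-< {k} {1} {0} (s≤s z≤n) 1≤k)

    assemble : ∀ y → Cases y → RT y
    assemble y (inj₁ (refl , refl , refl)) = ([-] , (1≤k ∷ []) , refl) , refl , ≤-refl , refl , [] , []
    assemble (lam , ts) (inj₂ (inj₁ (rt , e))) = subst RT e (below-repeat (drop 1 lam) (map pred ts) rt)
      where
      below-repeat : ∀ r t → RightTuple k (suc m') d (r , t) → RT (addRow k (r , t))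
      below-repeat [] t (_ , first≡k , _) = ⊥-elim (<⇒≢ 1≤k first≡k)
      below-repeat (y ∷ r) t ((dec , pos , sum≡) , refl , c≤m , count , inc , ps) =
        ((≤-refl ∷ dec) , (1≤k ∷ pos) , cong (y +_) sum≡) , refl ,
        subst (_≤ suc m') (sym (corners-repeat y r)) c≤m ,
        trans (cong₂ _+_ (length-map suc t) (corners-repeat y r)) count ,
        increasing-up t inc , shift-up y (y ∷ r) t ps
    assemble (lam , ts) (inj₂ (inj₂ (inj₁ (rt , e)))) = subst RT e (below-marked (drop 1 lam) (map pred (drop 1 ts)) rt)
      where
      below-marked : ∀ r t → RightTuple k m' d (r , t) → RT (addRowMarked k (r , t))
      below-marked [] t (_ , first≡k , _) = ⊥-elim (<⇒≢ 1≤k first≡k)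
      below-marked (y ∷ r) t ((dec , pos , sum≡) , refl , c≤m , count , inc , ps) =
        ((≤-refl ∷ dec) , (1≤k ∷ pos) , cong (y +_) sum≡) , refl ,
        subst (_≤ suc m') (sym (corners-repeat y r)) (≤-trans (m≤n+m _ (length t)) (m≤n⇒m≤1+n (≤-reflexive count))) ,
        cong suc (trans (cong₂ _+_ (length-map suc t) (corners-repeat y r)) count) ,
        starts-at-1 t (positions-positive t ps) (increasing-up t inc) ,
        ((s≤s z≤n , s≤s (s≤s z≤n) , refl) ∷ shift-up y (y ∷ r) t ps)
        where
        starts-at-1 : ∀ t → All (1 ≤_) t → Linked _<_ (map suc t) → Linked _<_ (1 ∷ map suc t)
        starts-at-1 [] _ _ = [-]
        starts-at-1 (a ∷ t) (1≤a ∷ _) inc = s≤s 1≤a ∷ inc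
    assemble (lam , ts) (inj₂ (inj₂ (inj₂ ((1≤h , h≤k-1 , rt) , e)))) = subst RT e (below-smaller (drop 1 lam) (map pred ts) 1≤h h≤k-1 rt)
      where
      below-smaller : ∀ r t → 1 ≤ part r 1 → part r 1 ≤ k ∸ 1 → RightTuple (part r 1) m' d (r , t) → RT (addRow k (r , t))
      below-smaller [] t () _ _
      below-smaller (y ∷ r) t _ y≤k-1 ((dec , pos , sum≡) , _ , c≤m , count , inc , ps) =
        ((≤-trans y≤k-1 (m∸n≤m k 1) ∷ dec) , (1≤k ∷ pos) , cong (k +_) sum≡) , refl ,
        subst (_≤ suc m') (sym new) (s≤s (≤-trans (m≤n+m _ (length t)) (≤-reflexive count))) ,
        trans (cong₂ _+_ (length-map suc t) new) (trans (+-suc (length t) _) (cong suc count)) ,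
        increasing-up t inc , shift-up k (y ∷ r) t ps
        where
        new : corners (k ∷ y ∷ r) ≡ suc (corners (y ∷ r))
        new = corners-new k y r (λ k≡y → k≰k-1 (subst (_≤ k ∸ 1) (sym k≡y) y≤k-1))

    classify : ∀ y → RT y → Cases y
    classify ([] , ts) (_ , first≡k , _) = ⊥-elim (<⇒≢ 1≤k first≡k)
    classify (x ∷ [] , []) ((_ , _ , sum≡) , refl , _ , count , _) =
      inj₁ (refl , sym (+-cancelˡ-≡ x _ _ sum≡) , sym (cong pred count))
    classify (x ∷ [] , t ∷ ts) (_ , _ , _ , _ , _ , ((1≤t , t<1 , _) ∷ _)) = ⊥-elim (<⇒≱ t<1 1≤t)
    classify (x ∷ y ∷ r , ts) ((dec , (_ ∷ pos) , sum≡) , refl , _ , count , inc , ps) with x ≟ y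
    ... | no x≢y = inj₂ (inj₂ (inj₂ (first-row-new ,
                     cong (x ∷ y ∷ r ,_) (proj₂ (remove-first-row x (y ∷ r) ts rest ge2 inc ps count′)))))
      where
      rest : IsPartition d (y ∷ r)
      rest = Linked.tail dec , pos , +-cancelˡ-≡ x _ _ sum≡
      ge2 = no-position-1 x (y ∷ r) ts x≢y ps
      count′ : length ts + corners (y ∷ r) ≡ m'
      count′ = cong pred (trans (sym (+-suc (length ts) _)) count)
      first-row-new : StartsBelow (y ∷ r , map pred ts)
      first-row-new = All.head pos , ≤-pred′ (≤∧≢⇒< (Linked.head dec) (λ y≡x → x≢y (sym y≡x))) ,
                      proj₁ (remove-first-row x (y ∷ r) ts rest ge2 inc ps count′)
    ... | yes refl with ts
    ...   | [] = inj₂ (inj₁ ((rest , refl , ≤-reflexive count , count , [] , []) , refl))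
      where
      rest : IsPartition d (x ∷ r)
      rest = Linked.tail dec , pos , +-cancelˡ-≡ x _ _ sum≡
    ...   | zero ∷ _ = ⊥-elim (position-0 ps)
    ...   | suc zero ∷ ts′ = inj₂ (inj₂ (inj₁ (proj₁ removed , cong (λ z → x ∷ x ∷ r , 1 ∷ z) (proj₂ removed))))
      where
      rest : IsPartition d (x ∷ r)
      rest = Linked.tail dec , pos , +-cancelˡ-≡ x _ _ sum≡
      removed = remove-first-row x (x ∷ r) ts′ rest (above 1 ts′ inc) (Linked.tail inc) (All.tail ps)
                  (cong pred count)
    ...   | suc (suc t) ∷ ts′ = inj₂ (inj₁ (proj₁ removed , cong (x ∷ x ∷ r ,_) (proj₂ removed)))
      where
      rest : IsPartition d (x ∷ r)
      rest = Linked.tail dec , pos , +-cancelˡ-≡ x _ _ sum≡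
      removed = remove-first-row x (x ∷ r) (suc (suc t) ∷ ts′) rest
                  (s≤s (s≤s z≤n) ∷ at-least-2 (suc (suc t)) ts′ (s≤s z≤n) (above _ ts′ inc)) inc ps
                  count

    disjoint-single : ∀ y → Single y → Repeated y ⊎ RepeatedMarked y ⊎ Smaller y → ⊥
    disjoint-single y (refl , _) (inj₁ ((_ , first≡k , _) , _)) = <⇒≢ 1≤k first≡k
    disjoint-single y (refl , _) (inj₂ (inj₁ ((_ , first≡k , _) , _))) = <⇒≢ 1≤k first≡k
    disjoint-single y (refl , _) (inj₂ (inj₂ ((() , _) , _)))

    disjoint-repeated : ∀ y → Repeated y → RepeatedMarked y ⊎ Smaller y → ⊥
    disjoint-repeated (lam , ts) ((_ , _ , _ , _ , _ , ps) , _) (inj₁ (_ , marked)) =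
      position-0 {drop 1 lam} (subst (λ t → RepeatPositions (drop 1 lam) (map pred t)) (sym (cong proj₂ marked)) ps)
    disjoint-repeated (lam , ts) ((_ , first≡k , _) , _) (inj₂ ((_ , h≤k-1 , _) , _)) =
      k≰k-1 (subst (_≤ k ∸ 1) first≡k h≤k-1)

    disjoint-marked : ∀ y → RepeatedMarked y → Smaller y → ⊥
    disjoint-marked y ((_ , first≡k , _) , _) ((_ , h≤k-1 , _) , _) = k≰k-1 (subst (_≤ k ∸ 1) first≡k h≤k-1)

  card-only-row : ∀ k m' d (1≤k : 1 ≤ k) → HasCard (FirstRow.Single k m' d 1≤k) (onlyRow d (suc m'))
  card-only-row k zero zero _ = card-cong (λ y y≡ → y≡ , refl , refl) (λ y → proj₁) (card-single (k ∷ [] , []))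
  card-only-row k (suc m') zero _ = card-empty (λ { y (_ , _ , ()) })
  card-only-row k m' (suc d) _ = card-empty (λ { y (_ , () , _) })

  rightCountWith : ℕ → ℕ → ℕ → ℕ → ℕ
  rightCountWith zero k m n = 0
  rightCountWith (suc fuel) k m n =
    if k ≤ᵇ n then firstRowSum (rightCountWith fuel) k m (n ∸ k) else 0

  card-first-row : ∀ (R : ℕ → ℕ → ℕ → ℕ) k m d → 1 ≤ k →
    (∀ h m → 1 ≤ h → HasCard (RightTuple h m d) (R h m d)) →
    HasCard (RightTuple k m (k + d)) (firstRowSum R k m d)
  card-first-row R k zero d 1≤k smaller =
    subst (HasCard (RightTuple k 0 (k + d)))
      (sym (trans (+-identityʳ _) (cong₂ _+_ (onlyRow-m0 d)
        (card-unique (smaller k 0 1≤k) (card-empty (λ y → no-tuple-m0 k d y 1≤k))))))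
      (card-empty (λ y → no-tuple-m0 k (k + d) y 1≤k))
  card-first-row R k (suc m') d 1≤k smaller =
    subst (HasCard (RightTuple k (suc m') (k + d))) (sym (+-assoc (onlyRow d (suc m')) _ _))
      (card-cong assemble classify
        (card-union disjoint-single (card-only-row k m' d 1≤k)
          (card-union disjoint-repeated (card-image (addRow k) removeRow (λ y _ → removeRow∘addRow k y) (smaller k (suc m') 1≤k))
            (card-union disjoint-marked
              (card-image (addRowMarked k) removeRowMarked (λ y _ → removeRowMarked∘addRowMarked k y) (smaller k m' 1≤k))
              (card-image (addRow k) removeRow (λ y _ → removeRow∘addRow k y) below)))))
    where
    open FirstRow k m' d 1≤k
    below : HasCard StartsBelow (sumTo (k ∸ 1) (λ h → R h m' d))
    below = card-fibres (λ x → part (proj₁ x) 1) (λ h x → RightTuple h m' d x) (λ h → R h m' d) (k ∸ 1)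
              (λ h 1≤h _ → card-cong (λ x rt → proj₁ (proj₂ rt) , rt) (λ x → proj₂) (smaller h m' 1≤h))

  card-rightCountWith : ∀ fuel k m n → 1 ≤ k → n < fuel → HasCard (RightTuple k m n) (rightCountWith fuel k m n)
  card-rightCountWith (suc fuel) k m n 1≤k n<fuel with k ≤ᵇ n in k≤ᵇn
  ... | false = card-empty (λ y rt → subst T k≤ᵇn (≤⇒≤ᵇ (subst (_≤ n) (proj₁ (proj₂ rt)) (first-row≤size n (proj₁ y) (proj₁ rt)))))
  ... | true = subst (λ z → HasCard (RightTuple k m z) (firstRowSum (rightCountWith fuel) k m (n ∸ k))) (m+[n∸m]≡n k≤n)
                 (card-first-row (rightCountWith fuel) k m (n ∸ k) 1≤k
                   (λ h m 1≤h → card-rightCountWith fuel h m (n ∸ k) 1≤h d<fuel))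
    where
    k≤n : k ≤ n
    k≤n = ≤ᵇ⇒≤ k n (subst T (sym k≤ᵇn) _)
    d<fuel : n ∸ k < fuel
    d<fuel = ≤-trans (∸-monoʳ-< 1≤k k≤n) (≤-pred n<fuel)

  rightCount : ℕ → ℕ → ℕ → ℕ
  rightCount k m n = rightCountWith (suc n) k m n

  card-rightCount : ∀ k m n → 1 ≤ k → HasCard (RightTuple k m n) (rightCount k m n)
  card-rightCount k m n 1≤k = card-rightCountWith (suc n) k m n 1≤k ≤-refl

  rightCount-small : ∀ k m n → 1 ≤ k → n < k → rightCount k m n ≡ 0
  rightCount-small k m n 1≤k n<k = card-unique (card-rightCount k m n 1≤k) (card-empty no-tuple)
    where
    no-tuple : ∀ y → RightTuple k m n y → ⊥
    no-tuple (lam , _) (partition , first≡k , _) = <⇒≱ n<k (subst (_≤ n) first≡k (first-row≤size n lam partition))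

  -- Uniqueness of cardinalities makes the first-row recursion hold for rightCount itself.
  rightCount-step : ∀ k m d → 1 ≤ k → rightCount k m (k + d) ≡ firstRowSum rightCount k m d
  rightCount-step k m d 1≤k =
    card-unique (card-rightCount k m (k + d) 1≤k)
      (card-first-row rightCount k m d 1≤k (λ h m 1≤h → card-rightCount h m d 1≤h))


module SubsetCounts where

  open Counting
  open SignedCounts using (parityCount)
  open import Data.Nat using (ℕ; zero; suc; _+_; _∸_; _≤_; _<_; _>_; s≤s; pred; _≤ᵇ_)
  open import Data.Nat.Properties
  open import Data.Nat.Combinatorics using (_C_; nCk+nC[k+1]≡[n+1]C[k+1])
  open import Data.Nat.ListAction using (sum)
  open import Data.Bool using (Bool; true; false; not; if_then_else_; T)
  open import Data.List using (List; []; _∷_; length; drop)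
  open import Data.List.Relation.Unary.All using (All; []; _∷_)
  open import Data.List.Relation.Unary.Linked as Linked using (Linked; []; [-]; _∷_)
  import Data.List.Relation.Unary.Linked.Properties as Linkedₚ
  open import Data.Product using (_×_; _,_)
  open import Data.Sum using (_⊎_; inj₁; inj₂)
  open import Data.Empty using (⊥; ⊥-elim)
  open import Relation.Nullary using (yes; no)
  open import Relation.Binary.PropositionalEquality using (_≡_; refl; sym; trans; cong; subst)

  evenᵇ : ℕ → Bool
  evenᵇ zero = true
  evenᵇ (suc n) = not (evenᵇ n)

  DecreasingIn : ℕ → ℕ → Bool → List ℕ → Set
  DecreasingIn j L b S = Linked _>_ S × All (λ s → j ≤ s × s < j + L) S × evenᵇ (length S) ≡ b

  IncreasingIn : ℕ → ℕ → ℕ → List ℕ → Set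
  IncreasingIn a N p I = Linked _<_ I × All (λ x → a ≤ x × x < a + N) I × length I ≡ p

  private
    empty-range : ∀ {j s} → j ≤ s → s < j + 0 → ⊥
    empty-range {j} j≤s s<j = <⇒≱ (subst (_ <_) (+-identityʳ j) s<j) j≤s

  below-head : ∀ {R : ℕ → ℕ → Set} → (∀ {a b c} → R a b → R b c → R a c) →
    ∀ v ts → Linked R (v ∷ ts) → All (R v) ts
  below-head R-trans v [] _ = []
  below-head R-trans v (t ∷ ts) (Rvt ∷ rest) = Linkedₚ.Linked⇒All R-trans Rvt rest

  not-injective : ∀ b c → not c ≡ b → c ≡ not b
  not-injective true false refl = refl
  not-injective false true refl = refl

  not-not : ∀ b → not (not b) ≡ b
  not-not true = refl
  not-not false = refl

  -- parityCount counts decreasing lists by sum: a list in [j, j+L+1) either avoids the top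
  -- element j+L or starts with it, and removing it flips the parity of the length.
  card-decreasing : ∀ j L r b → HasCard (λ S → DecreasingIn j L b S × sum S ≡ r) (parityCount j L r b)
  card-decreasing j zero zero true =
    card-cong (λ { S refl → ([] , [] , refl) , refl })
              (λ { [] _ → refl ; (s ∷ S) ((_ , ((j≤s , s<j) ∷ _) , _) , _) → ⊥-elim (empty-range j≤s s<j) })
              (card-single [])
  card-decreasing j zero zero false =
    card-empty (λ { [] ((_ , _ , ()) , _) ; (s ∷ S) ((_ , ((j≤s , s<j) ∷ _) , _) , _) → empty-range j≤s s<j })
  card-decreasing j zero (suc r) b =
    card-empty (λ { [] (_ , ()) ; (s ∷ S) ((_ , ((j≤s , s<j) ∷ _) , _) , _) → empty-range j≤s s<j })
  card-decreasing j (suc L) r b =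
    card-cong merge split (card-union disjoint (card-decreasing j L r b) (card-image (top ∷_) (drop 1) (λ _ _ → refl) with-top))
    where
    top = j + L
    top<end : top < j + suc L
    top<end = subst (top <_) (sym (+-suc j L)) ≤-refl
    WithTop : List ℕ → Set
    WithTop S = DecreasingIn j L (not b) S × top + sum S ≡ r

    with-top : HasCard WithTop (if top ≤ᵇ r then parityCount j L (r ∸ top) (not b) else 0)
    with-top with top ≤ᵇ r in top≤ᵇr
    ... | true = card-cong (λ S (dec , sum≡) → dec , trans (cong (top +_) sum≡) (m+[n∸m]≡n top≤r))
                           (λ S (dec , sum≡) → dec , +-cancelˡ-≡ top _ _ (trans sum≡ (sym (m+[n∸m]≡n top≤r))))
                           (card-decreasing j L (r ∸ top) (not b))
      where
      top≤r : top ≤ r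
      top≤r = ≤ᵇ⇒≤ top r (subst T (sym top≤ᵇr) _)
    ... | false = card-empty (λ S (_ , sum≡) → subst T top≤ᵇr (≤⇒≤ᵇ (subst (top ≤_) sum≡ (m≤m+n top _))))

    widen : ∀ S → All (λ s → j ≤ s × s < j + L) S → All (λ s → j ≤ s × s < j + suc L) S
    widen [] [] = []
    widen (s ∷ S) ((j≤s , s<) ∷ bs) = (j≤s , subst (s <_) (sym (+-suc j L)) (m≤n⇒m≤1+n s<)) ∷ widen S bs

    narrow : ∀ S u → u ≤ top → All (λ s → j ≤ s × s < j + suc L) S → All (_< u) S → All (λ s → j ≤ s × s < j + L) S
    narrow [] u _ [] [] = []
    narrow (s ∷ S) u u≤top ((j≤s , _) ∷ bs) (s<u ∷ ls) = (j≤s , ≤-trans s<u u≤top) ∷ narrow S u u≤top bs ls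

    merge : ∀ S → (DecreasingIn j L b S × sum S ≡ r) ⊎ (WithTop (drop 1 S) × top ∷ drop 1 S ≡ S) →
            DecreasingIn j (suc L) b S × sum S ≡ r
    merge S (inj₁ ((dec , bs , par) , sum≡)) = (dec , widen S bs , par) , sum≡
    merge (s ∷ S) (inj₂ (((dec , bs , par) , sum≡) , refl)) =
      (start S bs dec , ((m≤m+n j L , top<end) ∷ widen S bs) , trans (cong not par) (not-not b)) , sum≡
      where
      start : ∀ S → All (λ s → j ≤ s × s < j + L) S → Linked _>_ S → Linked _>_ (top ∷ S)
      start [] _ _ = [-]
      start (s ∷ S) ((_ , s<top) ∷ _) dec = s<top ∷ dec

    split : ∀ S → DecreasingIn j (suc L) b S × sum S ≡ r →
            (DecreasingIn j L b S × sum S ≡ r) ⊎ (WithTop (drop 1 S) × top ∷ drop 1 S ≡ S)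
    split [] ((dec , bs , par) , sum≡) = inj₁ (([] , [] , par) , sum≡)
    split (s ∷ S) ((dec , ((j≤s , s<end) ∷ bs) , par) , sum≡) with s ≟ top
    ... | yes refl = inj₂ (((Linked.tail dec , narrow S s ≤-refl bs (below-head (λ a b → <-trans b a) s S dec) ,
                             not-injective b (evenᵇ (length S)) par) , sum≡) , refl)
    ... | no s≢top = inj₁ ((dec , ((j≤s , s<top) ∷ narrow S s (<⇒≤ s<top) bs (below-head (λ a b → <-trans b a) s S dec)) , par) , sum≡)
      where
      s<top : s < top
      s<top = ≤∧≢⇒< (≤-pred (subst (suc s ≤_) (+-suc j L) s<end)) s≢top

    disjoint : ∀ S → DecreasingIn j L b S × sum S ≡ r → WithTop (drop 1 S) × top ∷ drop 1 S ≡ S → ⊥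
    disjoint (s ∷ S) ((_ , ((_ , s<top) ∷ _) , _) , _) (_ , refl) = <-irrefl refl s<top

  -- Increasing lists of length p in a range of N elements: N choose p, by whether the
  -- smallest element a is used.
  card-increasing : ∀ a N p → HasCard (IncreasingIn a N p) (N C p)
  card-increasing a zero zero =
    card-cong (λ { I refl → [] , [] , refl })
              (λ { [] _ → refl ; (x ∷ I) (_ , ((a≤x , x<a) ∷ _) , _) → ⊥-elim (empty-range a≤x x<a) })
              (card-single [])
  card-increasing a zero (suc p) =
    card-empty (λ { [] (_ , _ , ()) ; (x ∷ I) (_ , ((a≤x , x<a) ∷ _) , _) → empty-range a≤x x<a })
  card-increasing a (suc N) zero = card-cong no-elements no-elements (card-increasing (suc a) N zero)
    where
    no-elements : ∀ {a′ N′ a″ N″} I → IncreasingIn a′ N′ 0 I → IncreasingIn a″ N″ 0 I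
    no-elements [] _ = [] , [] , refl
  card-increasing a (suc N) (suc p) =
    subst (HasCard (IncreasingIn a (suc N) (suc p))) (trans (+-comm (N C suc p) (N C p)) (nCk+nC[k+1]≡[n+1]C[k+1] N p))
      (card-cong merge split (card-union disjoint (card-increasing (suc a) N (suc p))
        (card-image (a ∷_) (drop 1) (λ _ _ → refl) (card-increasing (suc a) N p))))
    where
    end≡ : a + suc N ≡ suc a + N
    end≡ = +-suc a N

    widen : ∀ I → All (λ x → suc a ≤ x × x < suc a + N) I → All (λ x → a ≤ x × x < a + suc N) I
    widen [] [] = []
    widen (x ∷ I) ((a<x , x<) ∷ bs) = (<⇒≤ a<x , subst (x <_) (sym end≡) x<) ∷ widen I bs

    narrow : ∀ I u → a ≤ u → All (λ x → a ≤ x × x < a + suc N) I → All (u <_) I → All (λ x → suc a ≤ x × x < suc a + N) I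
    narrow [] u _ [] [] = []
    narrow (x ∷ I) u a≤u ((_ , x<) ∷ bs) (u<x ∷ ls) = (≤-trans (s≤s a≤u) u<x , subst (x <_) end≡ x<) ∷ narrow I u a≤u bs ls

    merge : ∀ I → IncreasingIn (suc a) N (suc p) I ⊎ (IncreasingIn (suc a) N p (drop 1 I) × a ∷ drop 1 I ≡ I) →
            IncreasingIn a (suc N) (suc p) I
    merge I (inj₁ (inc , bs , len)) = inc , widen I bs , len
    merge (x ∷ I) (inj₂ ((inc , bs , len) , refl)) =
      start I bs inc , ((≤-refl , subst (a <_) (sym end≡) (s≤s (m≤m+n a N))) ∷ widen I bs) , cong suc len
      where
      start : ∀ I → All (λ x → suc a ≤ x × x < suc a + N) I → Linked _<_ I → Linked _<_ (a ∷ I)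
      start [] _ _ = [-]
      start (y ∷ I) ((a<y , _) ∷ _) inc = a<y ∷ inc

    split : ∀ I → IncreasingIn a (suc N) (suc p) I →
            IncreasingIn (suc a) N (suc p) I ⊎ (IncreasingIn (suc a) N p (drop 1 I) × a ∷ drop 1 I ≡ I)
    split (x ∷ I) (inc , ((a≤x , x<) ∷ bs) , len) with x ≟ a
    ... | yes refl = inj₂ ((Linked.tail inc , narrow I x ≤-refl bs (below-head <-trans x I inc) , cong pred len) , refl)
    ... | no x≢a = inj₁ (inc , ((≤∧≢⇒< a≤x (λ a≡x → x≢a (sym a≡x)) , subst (x <_) end≡ x<) ∷ narrow I x a≤x bs (below-head <-trans x I inc)) , len)

    disjoint : ∀ I → IncreasingIn (suc a) N (suc p) I → IncreasingIn (suc a) N p (drop 1 I) × a ∷ drop 1 I ≡ I → ⊥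
    disjoint (x ∷ I) (_ , ((a<x , _) ∷ _) , _) (_ , refl) = <-irrefl refl a<x


module LeftCount where

  open import Defs
  open Counting
  open SignedCounts using (prefixChoices; parityCount)
  open SubsetCounts
  open import Data.Nat using (ℕ; zero; suc; _+_; _∸_; _*_; _≤_; _<_; _>_; pred; _≤ᵇ_; _%_)
  open import Data.Nat.Properties
  open import Data.Nat.ListAction using (sum)
  open import Data.Bool using (Bool; true; false; if_then_else_; T)
  open import Data.List using (List; []; _∷_; length; _++_; [_]; drop)
  open import Data.List.Properties using (length-++)
  open import Data.List.Relation.Unary.All as All using (All; []; _∷_)
  import Data.List.Relation.Unary.All.Properties as Allₚ
  open import Data.List.Relation.Unary.Linked as Linked using (Linked; []; [-]; _∷_)
  open import Data.Product using (_×_; _,_; proj₁; proj₂)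
  open import Data.Empty using (⊥-elim)
  open import Relation.Binary.PropositionalEquality using (_≡_; refl; sym; trans; cong; cong₂; subst)

  -- The parity condition on ℓ(λ): b = true selects odd length, b = false even length.
  ParityIs : Bool → ℕ → Set
  ParityIs b n = n % 2 ≡ (if b then 1 else 0)

  -- ℓ(λ) = 1 + ℓ(λ₂, …): odd length of λ means even length of the remaining rows.
  parity-suc : ∀ n → suc n % 2 ≡ (if evenᵇ n then 1 else 0)
  parity-suc zero = refl
  parity-suc (suc zero) = refl
  parity-suc (suc (suc n)) = trans (parity-suc n) (cong (λ c → if c then 1 else 0) (sym (not-not (evenᵇ n))))

  parity-suc⁺ : ∀ b n → evenᵇ n ≡ b → ParityIs b (suc n)
  parity-suc⁺ b n refl = parity-suc n

  parity-suc⁻ : ∀ b n → ParityIs b (suc n) → evenᵇ n ≡ b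
  parity-suc⁻ b n p = bit-injective (evenᵇ n) b (trans (sym (parity-suc n)) p)
    where
    bit-injective : ∀ c b → (if c then 1 else 0) ≡ (if b then 1 else 0) → c ≡ b
    bit-injective true true _ = refl
    bit-injective false false _ = refl
    bit-injective true false ()
    bit-injective false true ()

  initial : List ℕ → List ℕ
  initial [] = []
  initial (x ∷ []) = []
  initial (x ∷ y ∷ ys) = x ∷ initial (y ∷ ys)

  lastElem-snoc : ∀ I j → lastElem (I ++ [ j ]) ≡ j
  lastElem-snoc [] j = refl
  lastElem-snoc (x ∷ []) j = refl
  lastElem-snoc (x ∷ y ∷ I) j = lastElem-snoc (y ∷ I) j

  initial-snoc : ∀ I j → initial (I ++ [ j ]) ≡ I
  initial-snoc [] j = refl
  initial-snoc (x ∷ []) j = refl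
  initial-snoc (x ∷ y ∷ I) j = cong (x ∷_) (initial-snoc (y ∷ I) j)

  initial-last : ∀ x xs → initial (x ∷ xs) ++ [ lastElem (x ∷ xs) ] ≡ x ∷ xs
  initial-last x [] = refl
  initial-last x (y ∷ xs) = cong (x ∷_) (initial-last y xs)

  All-lastElem : ∀ {P : ℕ → Set} x xs → All P (x ∷ xs) → P (lastElem (x ∷ xs))
  All-lastElem x [] (p ∷ []) = p
  All-lastElem x (y ∷ xs) (_ ∷ ps) = All-lastElem y xs ps

  lastElem-minimum : ∀ x xs → Linked _>_ (x ∷ xs) → All (lastElem (x ∷ xs) ≤_) (x ∷ xs)
  lastElem-minimum x [] _ = ≤-refl ∷ []
  lastElem-minimum x (y ∷ xs) (y<x ∷ dec) with lastElem-minimum y xs dec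
  ... | bounds@(last≤y ∷ _) = ≤-trans last≤y (<⇒≤ y<x) ∷ bounds

  increasing-snoc⁻ : ∀ I j → Linked _<_ (I ++ [ j ]) → Linked _<_ I × All (_< j) I
  increasing-snoc⁻ [] j _ = [] , []
  increasing-snoc⁻ (x ∷ []) j (x<j ∷ _) = [-] , (x<j ∷ [])
  increasing-snoc⁻ (x ∷ y ∷ I) j (x<y ∷ inc) with increasing-snoc⁻ (y ∷ I) j inc
  ... | (inc′ , bounds@(y<j ∷ _)) = (x<y ∷ inc′) , (<-trans x<y y<j ∷ bounds)

  increasing-snoc⁺ : ∀ I j → Linked _<_ I → All (_< j) I → Linked _<_ (I ++ [ j ])
  increasing-snoc⁺ [] j _ _ = [-]
  increasing-snoc⁺ (x ∷ []) j _ (x<j ∷ _) = x<j ∷ [-]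
  increasing-snoc⁺ (x ∷ y ∷ I) j (x<y ∷ inc) (_ ∷ bounds) = x<y ∷ increasing-snoc⁺ (y ∷ I) j inc bounds

  lastElem-≤-head : ∀ x xs → Linked _>_ (x ∷ xs) → lastElem (x ∷ xs) ≤ x
  lastElem-≤-head x xs dec = All.head (lastElem-minimum x xs dec)

  split-indices : ∀ m' B i is → Linked _<_ (i ∷ is) → All (λ i → 1 ≤ i × i ≤ B) (i ∷ is) → length (i ∷ is) ≡ suc m' →
    1 ≤ lastElem (i ∷ is) × lastElem (i ∷ is) ≤ B × IncreasingIn 1 (lastElem (i ∷ is) ∸ 1) m' (initial (i ∷ is))
  split-indices m' B i is inc bounds len =
    1≤j , j≤B ,
    (proj₁ prefix , All.zip (All.map proj₁ boundsI , All.map (subst (_ <_) (sym (m+[n∸m]≡n 1≤j))) (proj₂ prefix)) , lenI)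
    where
    j = lastElem (i ∷ is)
    I = initial (i ∷ is)
    split : I ++ [ j ] ≡ i ∷ is
    split = initial-last i is
    1≤j = proj₁ (All-lastElem i is bounds)
    j≤B = proj₂ (All-lastElem i is bounds)
    prefix : Linked _<_ I × All (_< j) I
    prefix = increasing-snoc⁻ I j (subst (Linked _<_) (sym split) inc)
    boundsI : All (λ i → 1 ≤ i × i ≤ B) I
    boundsI = Allₚ.++⁻ˡ I (subst (All (λ i → 1 ≤ i × i ≤ B)) (sym split) bounds)
    lenI : length I ≡ m'
    lenI = cong pred (trans (sym (+-comm (length I) 1)) (trans (sym (length-++ I)) (trans (cong length split) len)))

  -- A left tuple (λ, i₁ … i_m) corresponds to the triple (j, I, S) with j = i_m,
  -- I = (i₁ … i_{m-1}) ⊂ [1, j-1] and S = (λ₂ > … > λ_ℓ) ⊂ [j, j+k-1), where λ₁ = j + k - 1.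
  module LeftTuples (k m' n : ℕ) (b : Bool) (1≤k : 1 ≤ k) where

    -- λ₁ - i_m = k - 1.
    L = k ∸ 1

    LeftTupleOfParity : List ℕ × List ℕ → Set
    LeftTupleOfParity y = LeftTuple k (suc m') n y × ParityIs b (length (proj₁ y))

    Triple : ℕ → ℕ × (List ℕ × List ℕ) → Set
    Triple j (_ , I , S) = IncreasingIn 1 (j ∸ 1) m' I × (DecreasingIn j L b S × j + L + sum S ≡ n)

    ValidTriple : ℕ × (List ℕ × List ℕ) → Set
    ValidTriple x = 1 ≤ proj₁ x × proj₁ x ≤ n × Triple (proj₁ x) x

    toTuple : ℕ × (List ℕ × List ℕ) → List ℕ × List ℕ
    toTuple (j , I , S) = (j + L ∷ S , I ++ [ j ])

    toTriple : List ℕ × List ℕ → ℕ × (List ℕ × List ℕ)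
    toTriple (lam , is) = (lastElem is , initial is , drop 1 lam)

    toTriple∘toTuple : ∀ x → ValidTriple x → toTriple (toTuple x) ≡ x
    toTriple∘toTuple (j , I , S) _ = cong₂ _,_ (lastElem-snoc I j) (cong (_, S) (initial-snoc I j))

    tailCount : ℕ → ℕ
    tailCount j = if j + L ≤ᵇ n then parityCount j L (n ∸ (j + L)) b else 0

    card-tails : ∀ j → HasCard (λ S → DecreasingIn j L b S × j + L + sum S ≡ n) (tailCount j)
    card-tails j with j + L ≤ᵇ n in top≤ᵇn
    ... | true = card-cong (λ S (dec , sum≡) → dec , trans (cong (j + L +_) sum≡) (m+[n∸m]≡n top≤n))
                           (λ S (dec , sum≡) → dec , +-cancelˡ-≡ (j + L) _ _ (trans sum≡ (sym (m+[n∸m]≡n top≤n))))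
                           (card-decreasing j L (n ∸ (j + L)) b)
      where
      top≤n : j + L ≤ n
      top≤n = ≤ᵇ⇒≤ (j + L) n (subst T (sym top≤ᵇn) _)
    ... | false = card-empty (λ S (_ , sum≡) → subst T top≤ᵇn (≤⇒≤ᵇ (subst (j + L ≤_) sum≡ (m≤m+n (j + L) _))))

    card-fibre : ∀ j → HasCard (λ x → proj₁ x ≡ j × Triple j x) (prefixChoices j (suc m') * tailCount j)
    card-fibre j = card-cong (λ { (j′ , z) (t , e) → cong proj₁ (sym e) , t })
                             (λ { (j′ , z) (refl , t) → t , refl })
                             (card-image (j ,_) proj₂ (λ _ _ → refl) (card-prod (card-increasing 1 (j ∸ 1) m') (card-tails j)))

    leftCount : ℕ
    leftCount = sumTo n (λ j → prefixChoices j (suc m') * tailCount j)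

    card-triples : HasCard ValidTriple leftCount
    card-triples = card-fibres proj₁ Triple (λ j → prefixChoices j (suc m') * tailCount j) n (λ j _ _ → card-fibre j)

    toTuple-valid : ∀ x → ValidTriple x → LeftTupleOfParity (toTuple x)
    toTuple-valid (j , I , S) (1≤j , _ , (incI , boundsI , lenI) , ((decS , boundsS , par) , sum≡)) =
      ((first-row S boundsS decS , (≤-trans 1≤j (m≤m+n j L) ∷ All.map (λ p → ≤-trans 1≤j (proj₁ p)) boundsS) , sum≡) ,
       trans (length-++ I) (trans (+-comm (length I) 1) (cong suc lenI)) ,
       increasing-snoc⁺ I j incI (All.map (λ p → subst (_ <_) 1+[j-1]≡j (proj₂ p)) boundsI) ,
       Allₚ.++⁺ (All.map (λ p → proj₁ p , ≤-trans (<⇒≤ (subst (_ <_) 1+[j-1]≡j (proj₂ p))) j≤last) boundsI) ((1≤j , j≤last) ∷ []) ,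
       trans (cong (λ z → j + L ∸ z + 1) (lastElem-snoc I j)) (trans (cong (_+ 1) (m+n∸m≡n j L)) (m∸n+n≡m 1≤k))) ,
      parity-suc⁺ b (length S) par
      where
      1+[j-1]≡j : 1 + (j ∸ 1) ≡ j
      1+[j-1]≡j = m+[n∸m]≡n 1≤j
      first-row : ∀ S → All (λ s → j ≤ s × s < j + L) S → Linked _>_ S → Linked _>_ (j + L ∷ S)
      first-row [] _ _ = [-]
      first-row (s ∷ S) ((_ , s<top) ∷ _) dec = s<top ∷ dec
      j≤last : j ≤ lastElem (j + L ∷ S)
      j≤last = All-lastElem (j + L) S (m≤m+n j L ∷ All.map proj₁ boundsS)

    split-rows : ∀ M S j → Linked _>_ (M ∷ S) → j ≤ lastElem (M ∷ S) → arm1 (M ∷ S) j ≡ k →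
      j + L ≡ M × All (λ s → j ≤ s × s < j + L) S
    split-rows M S j dec j≤last arm =
      j+L≡M ,
      All.zip (All.map (≤-trans j≤last) (Allₚ.++⁻ʳ [ M ] minimum) ,
               All.map (subst (_ <_) (sym j+L≡M)) (below-head (λ a b → <-trans b a) M S dec))
      where
      minimum : All (lastElem (M ∷ S) ≤_) (M ∷ S)
      minimum = lastElem-minimum M S dec
      j≤M : j ≤ M
      j≤M = ≤-trans j≤last (All.head minimum)
      L≡M-j : L ≡ M ∸ j
      L≡M-j = trans (cong (_∸ 1) (sym arm)) (m+n∸n≡m (M ∸ j) 1)
      j+L≡M : j + L ≡ M
      j+L≡M = trans (cong (j +_) L≡M-j) (m+[n∸m]≡n j≤M)

    toTriple-valid : ∀ y → LeftTupleOfParity y → ValidTriple (toTriple y) × toTuple (toTriple y) ≡ y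
    toTriple-valid (lam , []) ((_ , () , _) , _)
    toTriple-valid ([] , i ∷ is) ((_ , _ , _ , ((1≤i , i≤0) ∷ _) , _) , _) = ⊥-elim (1+n≰n (≤-trans 1≤i i≤0))
    toTriple-valid (M ∷ S , i ∷ is) (((dec , _ , sum≡) , len , inc , bounds , arm) , par) =
      (1≤j , ≤-trans (≤-trans j≤last (lastElem-≤-head M S dec)) (subst (M ≤_) sum≡ (m≤m+n M _)) ,
       prefix , ((Linked.tail dec , proj₂ rows , parity-suc⁻ b (length S) par) , trans (cong (_+ sum S) (proj₁ rows)) sum≡)) ,
      cong₂ _,_ (cong (_∷ S) (proj₁ rows)) (initial-last i is)
      where
      j = lastElem (i ∷ is)
      indices = split-indices m' (lastElem (M ∷ S)) i is inc bounds len
      1≤j = proj₁ indices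
      j≤last = proj₁ (proj₂ indices)
      prefix = proj₂ (proj₂ indices)
      rows = split-rows M S j dec j≤last arm

    card-left : HasCard LeftTupleOfParity leftCount
    card-left = card-cong (λ y (t , e) → subst LeftTupleOfParity e (toTuple-valid (toTriple y) t))
                          toTriple-valid
                          (card-image toTuple toTriple toTriple∘toTuple card-triples)


open import Defs
open Counting using (sumTo; card-length)
open SignedCounts using (prefixChoices; parityCount; signedCount; signedCount-neg; x-y<0; +-minus-+)
open LeftFormula using (sumToℤ; sumToℤ-cong; leftTerm; leftSum; *-distribˡ-minus)
open FirstRowRecursion using (module Uniqueness)
open RightCount using (rightCount; card-rightCount; rightCount-small; rightCount-step)
open LeftCount using (module LeftTuples)
open import Data.Nat as ℕ using (ℕ; suc; _∸_; _≤_; _≤ᵇ_)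
import Data.Nat.Properties as ℕₚ
open import Data.Integer using (+_; _+_; _-_; _*_; +<+)
import Data.Integer.Properties as ℤₚ
open import Data.Integer.Tactic.RingSolver using (solve-∀)
open import Data.Bool using (true; false; T)
open import Data.List using (List; length)
open import Data.Product using (_×_; proj₁)
open import Relation.Binary.PropositionalEquality using (_≡_; refl; sym; trans; cong; cong₂; subst)
open Relation.Binary.PropositionalEquality.≡-Reasoning

sumTo-difference : ∀ B (f g : ℕ → ℕ) → + sumTo B f - + sumTo B g ≡ sumToℤ B (λ j → + f j - + g j)
sumTo-difference ℕ.zero f g = refl
sumTo-difference (suc B) f g = begin
    + (sumTo B f ℕ.+ f (suc B)) - + (sumTo B g ℕ.+ g (suc B))
  ≡⟨ cong₂ _-_ (ℤₚ.pos-+ (sumTo B f) (f (suc B))) (ℤₚ.pos-+ (sumTo B g) (g (suc B))) ⟩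
    (+ sumTo B f + + f (suc B)) - (+ sumTo B g + + g (suc B))
  ≡⟨ regroup (+ sumTo B f) (+ f (suc B)) (+ sumTo B g) (+ g (suc B)) ⟩
    (+ sumTo B f - + sumTo B g) + (+ f (suc B) - + g (suc B))
  ≡⟨ cong (_+ (+ f (suc B) - + g (suc B))) (sumTo-difference B f g) ⟩
    sumToℤ (suc B) (λ j → + f j - + g j)
  ∎
  where
  regroup : ∀ a b c d → (a + b) - (c + d) ≡ (a - c) + (b - d)
  regroup = solve-∀

left-difference : ∀ k m' n (1≤k : 1 ≤ k) →
  + LeftTuples.leftCount k m' n true 1≤k - + LeftTuples.leftCount k m' n false 1≤k ≡ leftSum k (suc m') (+ n)
left-difference k m' n 1≤k = trans (sumTo-difference n _ _) (sumToℤ-cong n _ _ (λ i _ → term (suc i)))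
  where
  L = k ∸ 1
  term : ∀ j → + (prefixChoices j (suc m') ℕ.* LeftTuples.tailCount k m' n true 1≤k j)
               - + (prefixChoices j (suc m') ℕ.* LeftTuples.tailCount k m' n false 1≤k j)
             ≡ leftTerm k (suc m') (+ n) j
  term j with j ℕ.+ L ≤ᵇ n in top≤ᵇn
  ... | true = begin
      + (c ℕ.* D true) - + (c ℕ.* D false)
    ≡⟨ cong₂ _-_ (ℤₚ.pos-* c (D true)) (ℤₚ.pos-* c (D false)) ⟩
      + c * + D true - + c * + D false
    ≡⟨ *-distribˡ-minus (+ c) (+ D true) (+ D false) ⟩
      + c * signedCount j L (+ (n ∸ (j ℕ.+ L)))
    ≡⟨ cong (λ z → + c * signedCount j L z) (sym (+-minus-+ n (j ℕ.+ L) (ℕₚ.≤ᵇ⇒≤ (j ℕ.+ L) n (subst T (sym top≤ᵇn) _)))) ⟩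
      leftTerm k (suc m') (+ n) j
    ∎
    where
    c = prefixChoices j (suc m')
    D = parityCount j L (n ∸ (j ℕ.+ L))
  ... | false = begin
      + (c ℕ.* 0) - + (c ℕ.* 0)
    ≡⟨ cong (λ z → + z - + z) (ℕₚ.*-zeroʳ c) ⟩
      + 0 - + 0
    ≡⟨ sym (ℤₚ.*-zeroʳ (+ c)) ⟩
      + c * + 0
    ≡⟨ cong (+ c *_) (sym (signedCount-neg j L _ (x-y<0 (+ n) (+ (j ℕ.+ L)) (+<+ n<top)))) ⟩
      leftTerm k (suc m') (+ n) j
    ∎
    where
    c = prefixChoices j (suc m')
    n<top = ℕₚ.≰⇒> (λ top≤n → subst T top≤ᵇn (ℕₚ.≤⇒≤ᵇ top≤n))

theorem4p1 : (k m n : ℕ) → 1 ≤ k → 1 ≤ m → 1 ≤ n →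
    (A B C : List (List ℕ × List ℕ)) →
    Enumerates (λ p → LeftTuple k m n p × Odd (length (proj₁ p))) A →
    Enumerates (λ p → LeftTuple k m n p × Even (length (proj₁ p))) B →
    Enumerates (RightTuple k m n) C →
    length A ≡ length B ℕ.+ length C
theorem4p1 (suc k') (suc m') n 1≤k _ _ A B C enumA enumB enumC = ℤₚ.+-injective (begin
    + length A                                  ≡⟨ solve-for-first (+ length A) (+ length B) ⟩
    + length B + (+ length A - + length B)      ≡⟨ cong (λ z → + length B + z) signed ⟩
    + length B + + length C                     ≡⟨ sym (ℤₚ.pos-+ (length B) (length C)) ⟩
    + (length B ℕ.+ length C)                   ∎)
  where
  k = suc k'
  open Uniqueness rightCount rightCount-small rightCount-step using (leftSum≡Rℤ)
  signed : + length A - + length B ≡ + length C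
  signed = begin
      + length A - + length B
    ≡⟨ cong₂ (λ a b → + a - + b) (card-length (LeftTuples.card-left k m' n true 1≤k) enumA)
                                  (card-length (LeftTuples.card-left k m' n false 1≤k) enumB) ⟩
      + LeftTuples.leftCount k m' n true 1≤k - + LeftTuples.leftCount k m' n false 1≤k
    ≡⟨ left-difference k m' n 1≤k ⟩
      leftSum k (suc m') (+ n)
    ≡⟨ leftSum≡Rℤ k' (suc m') (+ n) ⟩
      + rightCount k (suc m') n
    ≡⟨ cong +_ (sym (card-length (card-rightCount k (suc m') n 1≤k) enumC)) ⟩
      + length C
    ∎
  solve-for-first : ∀ a b → a ≡ b + (a - b)
  solve-for-first = solve-∀
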